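{- Let $\Gamma$ be a finite group and $s:\operatorname{Gal}(\mathbb{C}/\mathbb{R})\to\Gamma$ a homomorphism. For every class triple $(G,c,\pi)$ for $s$, \[|\operatorname{Aut}(G,c,\pi)|=|(\ker\pi)^{\operatorname{im}(s)}|\cdot|\operatorname{Aut}_\Gamma(\ker\pi)|.\] Further, for every finite $\Gamma$-module $H$ of order relatively prime to $|\Gamma|$ with $H^\Gamma$ trivial, there is a unique isomorphism class of class triples $(G,c,\pi)$ for $s$ with $\ker\pi$ isomorphic to $H$ as a $\Gamma$-module.
   Context: A class triple for $s$ is a triple $(G,c,\pi)$ where $G$ is a finite group and: (i) $\pi:G\to\Gamma$ is a surjective homomorphism whose kernel is abelian of order coprime to $|\Gamma|$; (ii) $c:\operatorname{Gal}(\mathbb{C}/\mathbb{R})\to G$ is a homomorphism with $\pi\circ c=s$; (iii) $(\ker\pi)^{\Gamma}$ is trivial, where $\Gamma$ acts on $\ker\pi$ by conjugation by preimages in $G$; (iv) $\operatorname{im}c\cap\ker\pi$ is trivial. A morphism $(G_1,c_1,\pi_1)\to(G_2,c_2,\pi_2)$ is a group homomorphism $\tau:G_1\to G_2$ with $\pi_1=\pi_2\circ\tau$ and $\tau\circ c_1=c_2$; $\operatorname{Aut}(G,c,\pi)$ is the group of invertible such endomorphisms. $\ker\pi$ is a $\Gamma$-module via the conjugation action, $\operatorname{Aut}_\Gamma$ denotes $\Gamma$-module automorphisms, and $(\ker\pi)^{\operatorname{im}(s)}$ is the subgroup fixed by $\operatorname{im}(s)\subseteq\Gamma$. -}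

module Defs where

open import Data.Nat using (ℕ; zero; suc; _*_)
open import Data.Fin using (Fin; zero; suc)
open import Data.Fin.Properties using (_≟_; all?; any?)
open import Data.Vec using (Vec; []; _∷_; lookup)
open import Data.List using (List; []; _∷_; length; filter; map; concatMap; allFin)
open import Data.Product using (Σ; ∃; _×_; _,_)
open import Relation.Nullary using (Dec; ¬_)
open import Relation.Nullary.Decidable using (_×-dec_; _→-dec_; ¬?)
open import Relation.Binary.PropositionalEquality
open import Algebra.Structures using (IsGroup; IsMonoid; IsSemigroup; IsMagma)
open import Data.Nat.Coprimality using (Coprime)

-- Finite groups, presented concretely on Fin n (every finite group is
-- isomorphic to one of these; all notions below are isomorphism invariant).

record FinGroup : Set where
  infixl 7 _∙_
  field
    size    : ℕ
    _∙_     : Fin size → Fin size → Fin size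
    ε       : Fin size
    _⁻¹     : Fin size → Fin size
    isGroup : IsGroup _≡_ _∙_ ε _⁻¹

open FinGroup public using (size)

El : FinGroup → Set
El G = Fin (size G)

IsHom : (G H : FinGroup) → (El G → El H) → Set
IsHom G H f = ∀ x y → f (x G.∙ y) ≡ f x H.∙ f y
  where module G = FinGroup G ; module H = FinGroup H

-- Gal(ℂ/ℝ): the group of order 2 (zero = identity, suc zero = conjugation)

c2op : Fin 2 → Fin 2 → Fin 2
c2op zero y = y
c2op (suc zero) zero = suc zero
c2op (suc zero) (suc zero) = zero

private
  c2assoc : ∀ x y z → c2op (c2op x y) z ≡ c2op x (c2op y z)
  c2assoc zero y z = refl
  c2assoc (suc zero) zero z = refl
  c2assoc (suc zero) (suc zero) zero = refl
  c2assoc (suc zero) (suc zero) (suc zero) = refl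

  c2idr : ∀ x → c2op x zero ≡ x
  c2idr zero = refl
  c2idr (suc zero) = refl

  c2inv : ∀ x → c2op x x ≡ zero
  c2inv zero = refl
  c2inv (suc zero) = refl

GalCR : FinGroup
GalCR = record
  { size = 2
  ; _∙_ = c2op
  ; ε = zero
  ; _⁻¹ = λ x → x
  ; isGroup = record
    { isMonoid = record
      { isSemigroup = record
        { isMagma = record { isEquivalence = isEquivalence ; ∙-cong = cong₂ c2op }
        ; assoc = c2assoc }
      ; identity = (λ x → refl) , c2idr }
    ; inverse = c2inv , c2inv
    ; ⁻¹-cong = λ p → p } }

countFin : ∀ {n} {P : Fin n → Set} → (∀ x → Dec (P x)) → ℕ
countFin {n} P? = length (filter P? (allFin n))

-- all vectors of length k over Fin n (= all functions Fin k → Fin n)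
allVecs : ∀ k n → List (Vec (Fin n) k)
allVecs zero n = [] ∷ []
allVecs (suc k) n = concatMap (λ x → map (x ∷_) (allVecs k n)) (allFin n)

countFun : ∀ {k n} {P : (Fin k → Fin n) → Set} → (∀ f → Dec (P f)) → ℕ
countFun {k} {n} P? = length (filter (λ v → P? (lookup v)) (allVecs k n))

module _ (Γ : FinGroup) where
  private module Γ = FinGroup Γ

  record ClassTriple (s : El GalCR → El Γ) : Set where
    field
      G  : FinGroup
    open FinGroup G
    field
      π       : Fin (FinGroup.size G) → El Γ
      π-hom   : IsHom G Γ π
      π-surj  : ∀ γ → ∃ λ g → π g ≡ γ
      c       : El GalCR → Fin (FinGroup.size G)
      c-hom   : IsHom GalCR G c
      π∘c≡s   : ∀ x → π (c x) ≡ s x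
      ker-abelian : ∀ x y → π x ≡ Γ.ε → π y ≡ Γ.ε → x ∙ y ≡ y ∙ x
      ker-coprime : Coprime (countFin (λ g → π g ≟ Γ.ε)) (size Γ)
      -- (iii) (ker π)^Γ trivial (Γ acts by conjugation by preimages)
      ker-fix-trivial : ∀ k → π k ≡ Γ.ε →
        (∀ γ g → π g ≡ γ → (g ∙ k) ∙ (g ⁻¹) ≡ k) → k ≡ ε
      imc∩ker : ∀ x → π (c x) ≡ Γ.ε → c x ≡ ε

  module _ {s : El GalCR → El Γ} (T : ClassTriple s) where
    open ClassTriple T
    open FinGroup G

    Bijective : (El G → El G) → Set
    Bijective τ = (∀ x y → τ x ≡ τ y → x ≡ y) × (∀ y → ∃ λ x → τ x ≡ y)

    bij? : ∀ τ → Dec (Bijective τ)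
    bij? τ = all? (λ x → all? (λ y → (τ x ≟ τ y) →-dec (x ≟ y)))
             ×-dec all? (λ y → any? (λ x → τ x ≟ y))

    IsAut : (El G → El G) → Set
    IsAut τ = IsHom G G τ × (∀ x → π (τ x) ≡ π x) × (∀ x → τ (c x) ≡ c x)
              × Bijective τ

    isAut? : ∀ τ → Dec (IsAut τ)
    isAut? τ = all? (λ x → all? (λ y → τ (x ∙ y) ≟ (τ x ∙ τ y)))
               ×-dec all? (λ x → π (τ x) ≟ π x)
               ×-dec all? (λ x → τ (c x) ≟ c x)
               ×-dec bij? τ

    autCount : ℕ
    autCount = countFun isAut?

    -- elements of (ker π)^{im s}: k ∈ ker π fixed by conjugation by every
    -- preimage of every element s(x) of im s
    IsFixedIms : El G → Set
    IsFixedIms k = (π k ≡ Γ.ε) ×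
      (∀ x g → π g ≡ s x → (g ∙ k) ∙ (g ⁻¹) ≡ k)

    isFixedIms? : ∀ k → Dec (IsFixedIms k)
    isFixedIms? k = (π k ≟ Γ.ε) ×-dec
      all? (λ x → all? (λ g → (π g ≟ s x) →-dec ((g ∙ k) ∙ (g ⁻¹) ≟ k)))

    fixCount : ℕ
    fixCount = countFin isFixedIms?

    -- Γ-module automorphisms of ker π, encoded as maps α : G → G which are
    -- the identity outside ker π and whose restriction to ker π is a
    -- Γ-equivariant group automorphism of ker π (these are in bijection
    -- with Aut_Γ(ker π)).
    IsAutΓ : (El G → El G) → Set
    IsAutΓ α =
      (∀ x → ¬ (π x ≡ Γ.ε) → α x ≡ x) ×
      (∀ k → π k ≡ Γ.ε → π (α k) ≡ Γ.ε) ×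
      (∀ k l → π k ≡ Γ.ε → π l ≡ Γ.ε → α (k ∙ l) ≡ α k ∙ α l) ×
      (∀ k l → π k ≡ Γ.ε → π l ≡ Γ.ε → α k ≡ α l → k ≡ l) ×
      (∀ l → π l ≡ Γ.ε → ∃ λ k → π k ≡ Γ.ε × α k ≡ l) ×
      (∀ g k → π k ≡ Γ.ε → α ((g ∙ k) ∙ (g ⁻¹)) ≡ (g ∙ α k) ∙ (g ⁻¹))

    private
      inK? : ∀ k → Dec (π k ≡ Γ.ε)
      inK? k = π k ≟ Γ.ε

    isAutΓ? : ∀ α → Dec (IsAutΓ α)
    isAutΓ? α =
      all? (λ x → ¬? (inK? x) →-dec (α x ≟ x)) ×-dec
      all? (λ k → inK? k →-dec inK? (α k)) ×-dec
      all? (λ k → all? (λ l → inK? k →-dec inK? l →-dec (α (k ∙ l) ≟ (α k ∙ α l)))) ×-dec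
      all? (λ k → all? (λ l → inK? k →-dec inK? l →-dec (α k ≟ α l) →-dec (k ≟ l))) ×-dec
      all? (λ l → inK? l →-dec any? (λ k → inK? k ×-dec (α k ≟ l))) ×-dec
      all? (λ g → all? (λ k → inK? k →-dec (α ((g ∙ k) ∙ (g ⁻¹)) ≟ ((g ∙ α k) ∙ (g ⁻¹)))))

    autΓCount : ℕ
    autΓCount = countFun isAutΓ?

  record GammaModule : Set where
    field
      H : FinGroup
    open FinGroup H
    field
      comm     : ∀ x y → x ∙ y ≡ y ∙ x
      act      : El Γ → El H → El H
      act-hom  : ∀ γ x y → act γ (x ∙ y) ≡ act γ x ∙ act γ y
      act-id   : ∀ x → act Γ.ε x ≡ x
      act-comp : ∀ γ δ x → act (γ Γ.∙ δ) x ≡ act γ (act δ x)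

  ModFixTrivial : GammaModule → Set
  ModFixTrivial M = ∀ h → (∀ γ → act γ h ≡ h) → h ≡ FinGroup.ε H
    where open GammaModule M

  -- ker π ≅ H as Γ-modules, witnessed by φ : G → H whose restriction to
  -- ker π is a Γ-equivariant group isomorphism ker π → H
  KerIso : ∀ {s} → ClassTriple s → GammaModule → Set
  KerIso T M =
    Σ (El G → El H) λ φ →
      (∀ k l → π k ≡ Γ.ε → π l ≡ Γ.ε → φ (k G.∙ l) ≡ φ k H.∙ φ l) ×
      (∀ k l → π k ≡ Γ.ε → π l ≡ Γ.ε → φ k ≡ φ l → k ≡ l) ×
      (∀ h → ∃ λ k → π k ≡ Γ.ε × φ k ≡ h) ×
      (∀ g k → π k ≡ Γ.ε → φ ((g G.∙ k) G.∙ (g G.⁻¹)) ≡ act (π g) (φ k))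
    where
      open ClassTriple T
      open GammaModule M
      module G = FinGroup G
      module H = FinGroup H

  TripleIso : ∀ {s} → ClassTriple s → ClassTriple s → Set
  TripleIso T₁ T₂ =
    Σ (El T₁.G → El T₂.G) λ τ → Σ (El T₂.G → El T₁.G) λ σ →
      IsHom T₁.G T₂.G τ ×
      (∀ x → T₂.π (τ x) ≡ T₁.π x) ×
      (∀ x → τ (T₁.c x) ≡ T₂.c x) ×
      (∀ x → σ (τ x) ≡ x) × (∀ y → τ (σ y) ≡ y)
    where
      module T₁ = ClassTriple T₁
      module T₂ = ClassTriple T₂

-- For a class triple (G, c, π) the kernel K = ker π is abelian of order
-- prime to |Γ|, so averaging over Γ (|Γ|-th roots in K) kills H¹(Γ, K) and
-- H²(Γ, K).  The second gives a homomorphic section σ of π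
-- (Schur–Zassenhaus); a further square-root argument in K makes σ extend c.
-- Fixing such σ, every g ∈ G is κ(g) · σ(π g) with κ(g) ∈ K.
--
-- Counting: an automorphism τ of (G, c, π) moves σ Γ by conjugation with a
-- unique h ∈ K (a coboundary, unique by (iii)), h is fixed by im c, and
-- τ = conj h ∘ (α on K, σ on Γ) with α = τ|K ∈ Aut_Γ(K); this is a bijection
-- Aut(G,c,π) ≅ K^{im s} × Aut_Γ(K).  Classification: the semidirect
-- product M ⋊ Γ realises a Γ-module M, and two realisations are isomorphic
-- by gluing the Γ-isomorphism K₁ ≅ M ≅ K₂ with their compatible sections.
module Submission where

open import Defs
open import Data.Nat using (ℕ; _*_)
open import Data.Fin as Fin using (Fin)
open import Algebra.Structures using (IsGroup)
open import Data.Nat.Coprimality using (Coprime)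
open import Data.Product using (Σ; _×_; _,_)
open import Relation.Binary.PropositionalEquality using (_≡_)

-- Counting finite sets by bijections between duplicate-free lists.
module Counting where

  open import Data.Nat using (zero; suc; _+_)
  open import Data.Vec using (Vec; []; _∷_; lookup; tabulate)
  open import Data.Vec.Properties using (lookup∘tabulate; tabulate∘lookup; tabulate-cong)
  import Data.Vec as Vec
  open import Data.List using (List; []; _∷_; length; map; filter; allFin; cartesianProduct; concatMap)
  open import Data.List.Properties using (length-map; length-++)
  open import Data.List.Membership.Propositional using (_∈_)
  open import Data.List.Membership.Propositional.Properties
    using (∈-map⁺; ∈-map⁻; ∈-filter⁺; ∈-filter⁻; ∈-cartesianProduct⁺; ∈-cartesianProduct⁻;
           ∈-allFin; ∈-++⁺ˡ; ∈-++⁺ʳ; ∈-++⁻)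
  open import Data.List.Membership.Propositional.Properties.WithK using (unique∧set⇒bag)
  open import Data.List.Relation.Binary.BagAndSetEquality using (_∼[_]_; set; ∼bag⇒↭)
  open import Data.List.Relation.Binary.Permutation.Propositional.Properties using (↭-length)
  open import Data.List.Relation.Unary.Any using (here; there)
  open import Data.List.Relation.Unary.All as All using (All; []; _∷_)
  import Data.List.Relation.Unary.All.Properties as All
  open import Data.List.Relation.Unary.AllPairs using ([]; _∷_)
  open import Data.List.Relation.Unary.Unique.Propositional using (Unique)
  import Data.List.Relation.Unary.Unique.Propositional.Properties as Unique
  open import Data.Product using (proj₁; proj₂)
  open import Data.Sum using (inj₁; inj₂)
  open import Data.Unit using (⊤; tt)
  open import Data.Empty using (⊥)
  open import Function.Bundles using (mk⇔)
  open import Relation.Nullary using (Dec; ¬_)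
  open import Relation.Unary using (Pred; Decidable)
  open import Relation.Binary.PropositionalEquality using (refl; sym; trans; cong; cong₂; subst; _≗_)

  private
    variable
      A B : Set

  record Lists {A : Set} (P : Pred A _) (xs : List A) : Set where
    field
      unique   : Unique xs
      sound    : ∀ {a} → a ∈ xs → P a
      complete : ∀ {a} → P a → a ∈ xs

  Enumerates : List A → Set
  Enumerates = Lists (λ _ → ⊤)

  map-unique : (f : A → B) {xs : List A} → Unique xs →
    (∀ {x y} → x ∈ xs → y ∈ xs → f x ≡ f y → x ≡ y) → Unique (map f xs)
  map-unique f {[]} [] inj = []
  map-unique f {x ∷ xs} (x∉xs ∷ u) inj =
    All.map⁺ (All.tabulate λ y∈xs fx≡fy → All.lookup x∉xs y∈xs (inj (here refl) (there y∈xs) fx≡fy))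
    ∷ map-unique f u (λ x∈ y∈ → inj (there x∈) (there y∈))

  length-bijection : {P : Pred A _} {Q : Pred B _} {xs : List A} {ys : List B} →
    Lists P xs → Lists Q ys → (f : A → B) (g : B → A) →
    (∀ {a} → P a → Q (f a)) → (∀ {b} → Q b → P (g b)) →
    (∀ {a} → P a → g (f a) ≡ a) → (∀ {b} → Q b → f (g b) ≡ b) →
    length xs ≡ length ys
  length-bijection {xs = xs} {ys} LP LQ f g fQ gP gf fg =
    trans (sym (length-map f xs)) (↭-length (∼bag⇒↭ (unique∧set⇒bag fxs-unique (Lists.unique LQ) same-elements)))
    where
    fxs-unique : Unique (map f xs)
    fxs-unique = map-unique f (Lists.unique LP) λ x∈ y∈ e →
      trans (sym (gf (Lists.sound LP x∈))) (trans (cong g e) (gf (Lists.sound LP y∈)))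
    same-elements : map f xs ∼[ set ] ys
    same-elements = mk⇔
      (λ b∈ → let (a , a∈ , b≡fa) = ∈-map⁻ f b∈ in
              subst (_∈ ys) (sym b≡fa) (Lists.complete LQ (fQ (Lists.sound LP a∈))))
      (λ b∈ → let qb = Lists.sound LQ b∈ in
              subst (_∈ map f xs) (fg qb) (∈-map⁺ f (Lists.complete LP (gP qb))))

  filter-lists : {P : Pred A _} (P? : Decidable P) {xs : List A} → Enumerates xs → Lists P (filter P? xs)
  filter-lists P? {xs} E = record
    { unique   = Unique.filter⁺ P? (Lists.unique E)
    ; sound    = λ a∈ → proj₂ (∈-filter⁻ P? {xs = xs} a∈)
    ; complete = λ pa → ∈-filter⁺ P? (Lists.complete E tt) pa }

  product-lists : {P : Pred A _} {Q : Pred B _} {xs : List A} {ys : List B} →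
    Lists P xs → Lists Q ys → Lists (λ ab → P (proj₁ ab) × Q (proj₂ ab)) (cartesianProduct xs ys)
  product-lists {xs = xs} {ys} LP LQ = record
    { unique   = Unique.cartesianProduct⁺ (Lists.unique LP) (Lists.unique LQ)
    ; sound    = λ ab∈ → let (a∈ , b∈) = ∈-cartesianProduct⁻ xs ys ab∈ in Lists.sound LP a∈ , Lists.sound LQ b∈
    ; complete = λ (pa , qb) → ∈-cartesianProduct⁺ (Lists.complete LP pa) (Lists.complete LQ qb) }

  length-cartesianProduct : (xs : List A) (ys : List B) →
    length (cartesianProduct xs ys) ≡ length xs * length ys
  length-cartesianProduct [] ys = refl
  length-cartesianProduct (x ∷ xs) ys = trans (length-++ (map (x ,_) ys))
    (cong₂ _+_ (length-map (x ,_) ys) (length-cartesianProduct xs ys))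

  allFin-enumerates : ∀ n → Enumerates (allFin n)
  allFin-enumerates n = record
    { unique = Unique.allFin⁺ n ; sound = λ _ → tt ; complete = λ {a} _ → ∈-allFin a }

  allVecs-enumerates : ∀ k n → Enumerates (allVecs k n)
  allVecs-enumerates k n = record { unique = unique k ; sound = λ _ → tt ; complete = λ {v} _ → complete k v }
    where
    extend : ∀ {k} → Fin n → List (Vec (Fin n) (suc k))
    extend {k} x = map (x ∷_) (allVecs k n)

    complete : ∀ k (v : Vec (Fin n) k) → v ∈ allVecs k n
    complete zero [] = here refl
    complete (suc k) (x ∷ v) = go (allFin n) (∈-allFin x)
      where
      go : ∀ xs → x ∈ xs → (x ∷ v) ∈ concatMap extend xs
      go (y ∷ xs) (here refl) = ∈-++⁺ˡ (∈-map⁺ (x ∷_) (complete k v))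
      go (y ∷ xs) (there x∈) = ∈-++⁺ʳ (extend y) (go xs x∈)

    head-of : ∀ {k y w} → w ∈ extend {k} y → Vec.head w ≡ y
    head-of {y = y} w∈ = let (_ , _ , w≡) = ∈-map⁻ (y ∷_) w∈ in cong Vec.head w≡

    unique : ∀ k → Unique (allVecs k n)
    unique zero = [] ∷ []
    unique (suc k) = go (allFin n) (Unique.allFin⁺ n)
      where
      disjoint : ∀ {y} xs → All (λ z → ¬ y ≡ z) xs → ∀ {w} → w ∈ extend y → w ∈ concatMap extend xs → ⊥
      disjoint (z ∷ xs) (y≢z ∷ y∉xs) w∈y w∈xs with ∈-++⁻ (extend z) w∈xs
      ... | inj₁ w∈z = y≢z (trans (sym (head-of w∈y)) (head-of w∈z))
      ... | inj₂ w∈xs' = disjoint xs y∉xs w∈y w∈xs'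
      go : ∀ xs → Unique xs → Unique (concatMap extend xs)
      go [] _ = []
      go (y ∷ xs) (y∉xs ∷ u) = Unique.++⁺ (Unique.map⁺ (cong Vec.tail) (unique k)) (go xs u)
        (λ (w∈y , w∈xs) → disjoint xs y∉xs w∈y w∈xs)

  -- Without function extensionality, functions are compared pointwise and
  -- all data must respect pointwise equality.
  record Decomposes {k n l : ℕ} (P : (Fin k → Fin n) → Set) (Q : Fin l → Set)
      (R : (Fin k → Fin n) → Set) : Set where
    field
      part₁ : (Fin k → Fin n) → Fin l
      part₂ : (Fin k → Fin n) → (Fin k → Fin n)
      join  : Fin l → (Fin k → Fin n) → (Fin k → Fin n)
      P-resp : ∀ {f g} → f ≗ g → P f → P g
      R-resp : ∀ {f g} → f ≗ g → R f → R g
      part₁-cong : ∀ {f g} → f ≗ g → part₁ f ≡ part₁ g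
      part₂-cong : ∀ {f g} → f ≗ g → part₂ f ≗ part₂ g
      join-cong  : ∀ q {f g} → f ≗ g → join q f ≗ join q g
      part₁-Q : ∀ {f} → P f → Q (part₁ f)
      part₂-R : ∀ {f} → P f → R (part₂ f)
      join-P  : ∀ {q r} → Q q → R r → P (join q r)
      join-parts  : ∀ {f} → P f → join (part₁ f) (part₂ f) ≗ f
      part₁-join : ∀ {q r} → Q q → R r → part₁ (join q r) ≡ q
      part₂-join : ∀ {q r} → Q q → R r → part₂ (join q r) ≗ r

  -- In that situation #P = #Q · #R; the bijection is transported to the
  -- vectors enumerated by allVecs.
  countFun-decomposes : ∀ {k n l} {P R : (Fin k → Fin n) → Set} {Q : Fin l → Set}
    (P? : ∀ f → Dec (P f)) (Q? : ∀ x → Dec (Q x)) (R? : ∀ f → Dec (R f)) →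
    Decomposes P Q R → countFun P? ≡ countFin Q? * countFun R?
  countFun-decomposes {k} {n} {l} {P} {R} {Q} P? Q? R? D =
    trans (length-bijection
            (filter-lists (λ v → P? (lookup v)) (allVecs-enumerates k n))
            (product-lists (filter-lists Q? (allFin-enumerates l)) (filter-lists (λ v → R? (lookup v)) (allVecs-enumerates k n)))
            split join′ (λ {v} → split-QR {v}) (λ {qv} → join-P′ {qv})
            (λ {v} → join-split {v}) (λ {qv} → split-join {qv}))
          (length-cartesianProduct (filter Q? (allFin l)) (filter (λ v → R? (lookup v)) (allVecs k n)))
    where
    open Decomposes D
    split : Vec (Fin n) k → Fin l × Vec (Fin n) k
    split v = part₁ (lookup v) , tabulate (part₂ (lookup v))
    join′ : Fin l × Vec (Fin n) k → Vec (Fin n) k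
    join′ (q , v) = tabulate (join q (lookup v))
    split-QR : ∀ {v} → P (lookup v) → Q (part₁ (lookup v)) × R (lookup (tabulate (part₂ (lookup v))))
    split-QR p = part₁-Q p , R-resp (λ i → sym (lookup∘tabulate _ i)) (part₂-R p)
    join-P′ : ∀ {qv} → Q (proj₁ qv) × R (lookup (proj₂ qv)) → P (lookup (join′ qv))
    join-P′ (q , r) = P-resp (λ i → sym (lookup∘tabulate _ i)) (join-P q r)
    join-split : ∀ {v} → P (lookup v) → join′ (split v) ≡ v
    join-split {v} p = trans (tabulate-cong λ i →
      trans (join-cong _ (lookup∘tabulate _) i) (join-parts p i)) (tabulate∘lookup v)
    split-join : ∀ {qv} → Q (proj₁ qv) × R (lookup (proj₂ qv)) → split (join′ qv) ≡ qv
    split-join {q , v} (qq , rv) = cong₂ _,_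
      (trans (part₁-cong (lookup∘tabulate _)) (part₁-join qq rv))
      (trans (tabulate-cong λ i → trans (part₂-cong (lookup∘tabulate _) i) (part₂-join qq rv i)) (tabulate∘lookup v))

module GroupFacts (G : FinGroup) where

  open import Data.Nat using (zero; suc; _+_)
  open import Algebra.Bundles using (Group)
  open import Data.Fin.Permutation using (Permutation; permutation)
  open import Relation.Binary.PropositionalEquality
  open ≡-Reasoning

  open FinGroup G public

  asGroup : Group _ _
  asGroup = record { isGroup = isGroup }

  open IsGroup isGroup public using (assoc; identityˡ; identityʳ; inverseˡ; inverseʳ)
  open import Algebra.Properties.Group asGroup public
    using (∙-cancelˡ; ∙-cancelʳ; inverseʳ-unique; identityˡ-unique; identityʳ-unique; ⁻¹-involutive; ε⁻¹≈ε;
           ⁻¹-anti-homo-∙; \\-leftDividesˡ; \\-leftDividesʳ; //-rightDividesˡ; //-rightDividesʳ)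

  conj : El G → El G → El G
  conj g x = (g ∙ x) ∙ g ⁻¹

  conj-hom : ∀ g x y → conj g (x ∙ y) ≡ conj g x ∙ conj g y
  conj-hom g x y = begin
    (g ∙ (x ∙ y)) ∙ g ⁻¹                    ≡⟨ cong (_∙ g ⁻¹) (sym (assoc g x y)) ⟩
    ((g ∙ x) ∙ y) ∙ g ⁻¹                    ≡⟨ cong (λ w → (w ∙ y) ∙ g ⁻¹) (sym (//-rightDividesˡ g (g ∙ x))) ⟩
    ((conj g x ∙ g) ∙ y) ∙ g ⁻¹             ≡⟨ cong (_∙ g ⁻¹) (assoc _ g y) ⟩
    (conj g x ∙ (g ∙ y)) ∙ g ⁻¹             ≡⟨ assoc _ _ _ ⟩
    conj g x ∙ conj g y                     ∎

  conj-ε : ∀ g → conj g ε ≡ ε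
  conj-ε g = trans (cong (_∙ g ⁻¹) (identityʳ g)) (inverseʳ g)

  conj-inv : ∀ g x → conj g (x ⁻¹) ≡ (conj g x) ⁻¹
  conj-inv g x = inverseʳ-unique (conj g x) (conj g (x ⁻¹))
    (trans (sym (conj-hom g x (x ⁻¹))) (trans (cong (conj g) (inverseʳ x)) (conj-ε g)))

  conj-comp : ∀ g h x → conj g (conj h x) ≡ conj (g ∙ h) x
  conj-comp g h x = begin
    (g ∙ ((h ∙ x) ∙ h ⁻¹)) ∙ g ⁻¹     ≡⟨ cong (_∙ g ⁻¹) (sym (assoc g _ _)) ⟩
    ((g ∙ (h ∙ x)) ∙ h ⁻¹) ∙ g ⁻¹     ≡⟨ assoc _ _ _ ⟩
    (g ∙ (h ∙ x)) ∙ (h ⁻¹ ∙ g ⁻¹)     ≡⟨ cong₂ _∙_ (sym (assoc g h x)) (sym (⁻¹-anti-homo-∙ g h)) ⟩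
    ((g ∙ h) ∙ x) ∙ (g ∙ h) ⁻¹        ∎

  conj-by-ε : ∀ x → conj ε x ≡ x
  conj-by-ε x = trans (cong₂ _∙_ (identityˡ x) ε⁻¹≈ε) (identityʳ x)

  conj-injective : ∀ g {x y} → conj g x ≡ conj g y → x ≡ y
  conj-injective g e = ∙-cancelˡ g _ _ (∙-cancelʳ (g ⁻¹) _ _ e)

  conj-shift : ∀ g x → g ∙ x ≡ conj g x ∙ g
  conj-shift g x = sym (//-rightDividesˡ g (g ∙ x))

  commute⇒conj-fixed : ∀ a b → a ∙ b ≡ b ∙ a → conj a b ≡ b
  commute⇒conj-fixed a b e = trans (cong (_∙ a ⁻¹) e) (//-rightDividesʳ a b)

  conj-fixed-sym : ∀ a b → conj a b ≡ b → conj b a ≡ a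
  conj-fixed-sym a b e = commute⇒conj-fixed b a (sym (trans (conj-shift a b) (cong (_∙ a) e)))

  infixr 8 _^_
  _^_ : El G → ℕ → El G
  x ^ zero = ε
  x ^ suc n = x ∙ x ^ n

  ^-+ : ∀ x a b → x ^ (a + b) ≡ x ^ a ∙ x ^ b
  ^-+ x zero b = sym (identityˡ _)
  ^-+ x (suc a) b = trans (cong (x ∙_) (^-+ x a b)) (sym (assoc _ _ _))

  ^-* : ∀ x a b → x ^ (b * a) ≡ (x ^ a) ^ b
  ^-* x a zero = refl
  ^-* x a (suc b) = trans (^-+ x a _) (cong (x ^ a ∙_) (^-* x a b))

  ε^ : ∀ n → ε ^ n ≡ ε
  ε^ zero = refl
  ε^ (suc n) = trans (identityˡ _) (ε^ n)

  conj-^ : ∀ g x n → conj g (x ^ n) ≡ conj g x ^ n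
  conj-^ g x zero = conj-ε g
  conj-^ g x (suc n) = trans (conj-hom g x (x ^ n)) (cong (conj g x ∙_) (conj-^ g x n))

  left-mul : El G → Permutation (FinGroup.size G) (FinGroup.size G)
  left-mul h = permutation (h ∙_) (h ⁻¹ ∙_) (\\-leftDividesˡ h) (\\-leftDividesʳ h)

module Hom {G H : FinGroup} (f : El G → El H) (f-hom : IsHom G H f) where

  open import Relation.Binary.PropositionalEquality
  private
    module G = GroupFacts G
    module H = GroupFacts H

  hom-ε : f G.ε ≡ H.ε
  hom-ε = H.identityʳ-unique (f G.ε) (f G.ε) (trans (sym (f-hom G.ε G.ε)) (cong f (G.identityˡ G.ε)))

  hom-inv : ∀ x → f (x G.⁻¹) ≡ (f x) H.⁻¹
  hom-inv x = H.inverseʳ-unique (f x) (f (x G.⁻¹))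
    (trans (sym (f-hom x (x G.⁻¹))) (trans (cong f (G.inverseʳ x)) hom-ε))

  hom-conj : ∀ g x → f (G.conj g x) ≡ H.conj (f g) (f x)
  hom-conj g x = trans (f-hom _ _) (cong₂ H._∙_ (f-hom g x) (hom-inv g))

-- A finite group containing an element β ≠ ε with β² = ε has even order:
-- γ ↦ βγ is a fixed-point-free involution, pairing off the elements.
module Parity (Γ : FinGroup) where

  open import Data.Nat using (zero; suc; _+_)
  open import Data.Nat.Properties using (+-0-commutativeMonoid; *-comm; +-identityʳ)
  open import Data.Nat.Divisibility using (_∣_; divides)
  open import Data.Fin.Properties using (_<?_; <-cmp; <-asym)
  open import Relation.Nullary using (yes; no; ¬_)
  open import Relation.Binary using (tri<; tri≈; tri>)
  open import Relation.Binary.PropositionalEquality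
  open import Data.Empty using (⊥-elim)
  import Algebra.Properties.CommutativeMonoid.Sum +-0-commutativeMonoid as ℕ-Sum
  open GroupFacts Γ
  open ≡-Reasoning

  private
    m = FinGroup.size Γ

    [_<_] : Fin m → Fin m → ℕ
    [ a < b ] with a <? b
    ... | yes _ = 1
    ... | no _ = 0

    [<]-distinct : ∀ a b → ¬ a ≡ b → [ a < b ] + [ b < a ] ≡ 1
    [<]-distinct a b a≢b with a <? b | b <? a
    ... | yes a<b | yes b<a = ⊥-elim (<-asym a<b b<a)
    ... | yes _ | no _ = refl
    ... | no _ | yes _ = refl
    ... | no a≮b | no b≮a with <-cmp a b
    ... | tri< a<b _ _ = ⊥-elim (a≮b a<b)
    ... | tri≈ _ a≡b _ = ⊥-elim (a≢b a≡b)
    ... | tri> _ _ b<a = ⊥-elim (b≮a b<a)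

    sum-ones : ∀ n → ℕ-Sum.sum {n} (λ _ → 1) ≡ n
    sum-ones zero = refl
    sum-ones (suc n) = cong suc (sum-ones n)

  involution⇒even : ∀ β → ¬ β ≡ ε → β ∙ β ≡ ε → 2 ∣ m
  involution⇒even β β≢ε ββ≡ε = divides (ℕ-Sum.sum below) (begin
    m                                                   ≡⟨ sym (sum-ones m) ⟩
    ℕ-Sum.sum {m} (λ _ → 1)                             ≡⟨ ℕ-Sum.sum-cong-≗ {m} (λ γ → sym ([<]-distinct γ (β ∙ γ) (no-fixed-point γ))) ⟩
    ℕ-Sum.sum (λ γ → below γ + [ β ∙ γ < γ ])           ≡⟨ ℕ-Sum.∑-distrib-+ below _ ⟩
    ℕ-Sum.sum below + ℕ-Sum.sum (λ γ → [ β ∙ γ < γ ])   ≡⟨ cong (ℕ-Sum.sum below +_) (ℕ-Sum.sum-cong-≗ {m} λ γ → cong [ β ∙ γ <_] (sym (ββγ γ))) ⟩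
    ℕ-Sum.sum below + ℕ-Sum.sum (λ γ → below (β ∙ γ))   ≡⟨ cong (ℕ-Sum.sum below +_) (sym (ℕ-Sum.∑-permute below (left-mul β))) ⟩
    ℕ-Sum.sum below + ℕ-Sum.sum below                   ≡⟨ cong (ℕ-Sum.sum below +_) (sym (+-identityʳ (ℕ-Sum.sum below))) ⟩
    2 * ℕ-Sum.sum below                                 ≡⟨ *-comm 2 (ℕ-Sum.sum below) ⟩
    ℕ-Sum.sum below * 2                                 ∎)
    where
    below : Fin m → ℕ
    below γ = [ γ < β ∙ γ ]
    no-fixed-point : ∀ γ → ¬ γ ≡ β ∙ γ
    no-fixed-point γ γ≡βγ = β≢ε (∙-cancelʳ γ _ _ (trans (sym γ≡βγ) (sym (identityˡ γ))))
    ββγ : ∀ γ → β ∙ (β ∙ γ) ≡ γ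
    ββγ γ = trans (sym (assoc β β γ)) (trans (cong (_∙ γ) ββ≡ε) (identityˡ γ))

module AbelianKernel (G Γ : FinGroup) (π : El G → El Γ) (π-hom : IsHom G Γ π)
    (ker-abelian : ∀ x y → π x ≡ FinGroup.ε Γ → π y ≡ FinGroup.ε Γ → FinGroup._∙_ G x y ≡ FinGroup._∙_ G y x) where

  open import Data.Nat using (ℕ; zero; suc; _+_)
  open import Data.Nat.Properties using (*-comm)
  open import Data.Fin using (Fin; zero; suc)
  open import Data.Fin.Properties using (_≟_)
  open import Data.List using (List; []; _∷_; length; filter; allFin; tabulate; foldr)
  open import Data.Product using (Σ; proj₁; proj₂)
  open import Data.Empty using (⊥-elim)
  open import Relation.Nullary using (yes; no; does)
  open import Data.Bool using (true; false; if_then_else_)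
  open import Relation.Binary.PropositionalEquality
  open import Algebra.Bundles using (CommutativeMonoid)
  import Algebra.Properties.CommutativeMonoid.Sum
  open import Data.Fin.Permutation using (Permutation; _⟨$⟩ʳ_)
  open import Data.Nat.Coprimality using (coprime-Bézout)
  open import Data.Nat.GCD using (module Bézout)

  open GroupFacts G public
  module Γ = GroupFacts Γ
  open Hom {G} {Γ} π π-hom public renaming (hom-ε to π-ε; hom-inv to π-inv; hom-conj to π-conj)
  open ≡-Reasoning

  K : El G → Set
  K x = π x ≡ Γ.ε

  K-ε : K ε
  K-ε = π-ε

  K-∙ : ∀ {x y} → K x → K y → K (x ∙ y)
  K-∙ {x} {y} kx ky = trans (π-hom x y) (trans (cong₂ Γ._∙_ kx ky) (Γ.identityˡ _))

  K-inv : ∀ {x} → K x → K (x ⁻¹)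
  K-inv {x} kx = trans (π-inv x) (trans (cong Γ._⁻¹ kx) Γ.ε⁻¹≈ε)

  K-^ : ∀ {x} n → K x → K (x ^ n)
  K-^ zero kx = K-ε
  K-^ (suc n) kx = K-∙ kx (K-^ n kx)

  K-conj : ∀ g {x} → K x → K (conj g x)
  K-conj g {x} kx = trans (π-conj g x) (trans (cong (Γ.conj (π g)) kx) (Γ.conj-ε (π g)))

  π-conj-K : ∀ {h} x → K h → π (conj h x) ≡ π x
  π-conj-K {h} x kh = trans (π-conj h x) (trans (cong (λ w → Γ.conj w (π x)) kh) (Γ.conj-by-ε (π x)))

  K-div : ∀ {a b} → π a ≡ π b → K (a ∙ b ⁻¹)
  K-div {a} {b} e = trans (π-hom a (b ⁻¹)) (trans (cong₂ Γ._∙_ e (π-inv b)) (Γ.inverseʳ (π b)))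

  comm : ∀ {x y} → K x → K y → x ∙ y ≡ y ∙ x
  comm kx ky = ker-abelian _ _ kx ky

  K-conj-K : ∀ {h x} → K h → K x → conj h x ≡ x
  K-conj-K kh kx = commute⇒conj-fixed _ _ (comm kh kx)

  interchange : ∀ {a b c d} → K b → K c → (a ∙ b) ∙ (c ∙ d) ≡ (a ∙ c) ∙ (b ∙ d)
  interchange {a} {b} {c} {d} kb kc = begin
    (a ∙ b) ∙ (c ∙ d)  ≡⟨ assoc a b _ ⟩
    a ∙ (b ∙ (c ∙ d))  ≡⟨ cong (a ∙_) (sym (assoc b c d)) ⟩
    a ∙ ((b ∙ c) ∙ d)  ≡⟨ cong (λ w → a ∙ (w ∙ d)) (comm kb kc) ⟩
    a ∙ ((c ∙ b) ∙ d)  ≡⟨ cong (a ∙_) (assoc c b d) ⟩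
    a ∙ (c ∙ (b ∙ d))  ≡⟨ sym (assoc a c _) ⟩
    (a ∙ c) ∙ (b ∙ d)  ∎

  ^-distrib : ∀ {x y} n → K x → K y → (x ∙ y) ^ n ≡ x ^ n ∙ y ^ n
  ^-distrib zero kx ky = sym (identityˡ ε)
  ^-distrib {x} {y} (suc n) kx ky =
    trans (cong ((x ∙ y) ∙_) (^-distrib n kx ky)) (interchange ky (K-^ n kx))

  ⁻¹-^ : ∀ {x} n → K x → (x ⁻¹) ^ n ≡ (x ^ n) ⁻¹
  ⁻¹-^ {x} n kx = inverseʳ-unique (x ^ n) ((x ⁻¹) ^ n) (begin
    x ^ n ∙ (x ⁻¹) ^ n   ≡⟨ sym (^-distrib n kx (K-inv kx)) ⟩
    (x ∙ x ⁻¹) ^ n       ≡⟨ cong (_^ n) (inverseʳ x) ⟩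
    ε ^ n                ≡⟨ ε^ n ⟩
    ε                    ∎)

  prod : ∀ {n} → (Fin n → El G) → El G
  prod {zero} f = ε
  prod {suc n} f = f zero ∙ prod (λ i → f (suc i))

  K-prod : ∀ {n} (f : Fin n → El G) → (∀ i → K (f i)) → K (prod f)
  K-prod {zero} f kf = K-ε
  K-prod {suc n} f kf = K-∙ (kf zero) (K-prod (λ i → f (suc i)) (λ i → kf (suc i)))

  prod-cong : ∀ {n} {f g : Fin n → El G} → (∀ i → f i ≡ g i) → prod f ≡ prod g
  prod-cong {zero} e = refl
  prod-cong {suc n} e = cong₂ _∙_ (e zero) (prod-cong (λ i → e (suc i)))

  prod-mul : ∀ {n} (f g : Fin n → El G) → (∀ i → K (f i)) → (∀ i → K (g i)) →
    prod (λ i → f i ∙ g i) ≡ prod f ∙ prod g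
  prod-mul {zero} f g kf kg = sym (identityˡ ε)
  prod-mul {suc n} f g kf kg =
    trans (cong ((f zero ∙ g zero) ∙_) (prod-mul _ _ (λ i → kf (suc i)) (λ i → kg (suc i))))
          (interchange (kg zero) (K-prod _ (λ i → kf (suc i))))

  prod-const : ∀ n x → prod {n} (λ _ → x) ≡ x ^ n
  prod-const zero x = refl
  prod-const (suc n) x = cong (x ∙_) (prod-const n x)

  prod-conj : ∀ {n} g (f : Fin n → El G) → conj g (prod f) ≡ prod (λ i → conj g (f i))
  prod-conj {zero} g f = conj-ε g
  prod-conj {suc n} g f = trans (conj-hom g _ _) (cong (conj g (f zero) ∙_) (prod-conj g (λ i → f (suc i))))

  -- reindexing by a permutation: K is a commutative monoid, so the library's
  -- invariance of finite sums applies
  private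
    K-monoid : CommutativeMonoid _ _
    K-monoid = record
      { Carrier = Σ (El G) K
      ; _≈_ = λ a b → proj₁ a ≡ proj₁ b
      ; _∙_ = λ a b → (proj₁ a ∙ proj₁ b) , K-∙ (proj₂ a) (proj₂ b)
      ; ε = ε , K-ε
      ; isCommutativeMonoid = record
        { isMonoid = record
          { isSemigroup = record
            { isMagma = record
              { isEquivalence = record { refl = refl ; sym = sym ; trans = trans }
              ; ∙-cong = cong₂ _∙_ }
            ; assoc = λ a b c → assoc _ _ _ }
          ; identity = (λ a → identityˡ _) , (λ a → identityʳ _) }
        ; comm = λ a b → comm (proj₂ a) (proj₂ b) } }

    module K-Sum = Algebra.Properties.CommutativeMonoid.Sum K-monoid

    prod≡sum : ∀ {n} (f : Fin n → El G) (kf : ∀ i → K (f i)) → prod f ≡ proj₁ (K-Sum.sum (λ i → f i , kf i))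
    prod≡sum {zero} f kf = refl
    prod≡sum {suc n} f kf = cong (f zero ∙_) (prod≡sum (λ i → f (suc i)) (λ i → kf (suc i)))

  prod-permute : ∀ {n} (f : Fin n → El G) → (∀ i → K (f i)) → (p : Permutation n n) →
    prod f ≡ prod (λ i → f (p ⟨$⟩ʳ i))
  prod-permute f kf p = trans (prod≡sum f kf) (trans (K-Sum.∑-permute (λ i → f i , kf i) p)
    (sym (prod≡sum (λ i → f (p ⟨$⟩ʳ i)) (λ i → kf (p ⟨$⟩ʳ i)))))

  order-K : ℕ
  order-K = countFin (λ g → π g ≟ Γ.ε)

  private
    _at_ : El G → El G → El G
    x at g = if does (π g ≟ Γ.ε) then x else ε

    K-at : ∀ {x} g → K x → K (x at g)
    K-at g kx with π g ≟ Γ.ε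
    ... | yes _ = kx
    ... | no _ = K-ε

    K-self-at : ∀ g → K (g at g)
    K-self-at g with π g ≟ Γ.ε
    ... | yes kg = kg
    ... | no _ = K-ε

    translate-at : ∀ {x} g → K x → (x ∙ g) at (x ∙ g) ≡ (x at g) ∙ (g at g)
    translate-at {x} g kx with π g ≟ Γ.ε | π (x ∙ g) ≟ Γ.ε
    ... | yes _ | yes _ = refl
    ... | yes kg | no ¬kxg = ⊥-elim (¬kxg (K-∙ kx kg))
    ... | no ¬kg | yes kxg = ⊥-elim (¬kg (subst K (\\-leftDividesʳ x g) (K-∙ (K-inv kx) kxg)))
    ... | no _ | no _ = sym (identityˡ ε)

    foldr-at : ∀ x (L : List (El G)) →
      foldr (λ g acc → (x at g) ∙ acc) ε L ≡ x ^ length (filter (λ g → π g ≟ Γ.ε) L)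
    foldr-at x [] = refl
    foldr-at x (g ∷ L) with does (π g ≟ Γ.ε)
    ... | true = cong (x ∙_) (foldr-at x L)
    ... | false = trans (identityˡ _) (foldr-at x L)

    prod≡foldr : ∀ {n} (h : El G → El G) (g : Fin n → El G) →
      prod (λ i → h (g i)) ≡ foldr (λ i acc → h i ∙ acc) ε (tabulate g)
    prod≡foldr {zero} h g = refl
    prod≡foldr {suc n} h g = cong (h (g zero) ∙_) (prod≡foldr h (λ i → g (suc i)))

  -- Lagrange's theorem for K: multiplying by x ∈ K permutes the factors of
  -- P = ∏_{g ∈ K} g, so x^|K| · P = P.
  lagrange : ∀ {x} → K x → x ^ order-K ≡ ε
  lagrange {x} kx = identityˡ-unique (x ^ order-K) P (begin
    x ^ order-K ∙ P                    ≡⟨ cong (_∙ P) (sym (trans (prod≡foldr (x at_) (λ g → g)) (foldr-at x (allFin _)))) ⟩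
    prod (x at_) ∙ P                   ≡⟨ sym (prod-mul (x at_) (λ g → g at g) (λ g → K-at g kx) K-self-at) ⟩
    prod (λ g → (x at g) ∙ (g at g))   ≡⟨ prod-cong (λ g → sym (translate-at g kx)) ⟩
    prod (λ g → (x ∙ g) at (x ∙ g))    ≡⟨ sym (prod-permute (λ g → g at g) K-self-at (left-mul x)) ⟩
    P                                  ∎)
    where
    P = prod (λ g → g at g)

  -- n-th roots in K for n coprime to |K|: by Bézout, y n ≡ ±1 modulo |K|
  -- for some y, so z ↦ z^{±y} inverts z ↦ z^n on K.
  module Roots (n : ℕ) (coprime : Coprime order-K n) where
    open Bézout.Identity using (+-; -+)

    private
      bézout = coprime-Bézout coprime

      ^-multiple-of-order : ∀ {z} a → K z → z ^ (a * order-K) ≡ ε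
      ^-multiple-of-order {z} a kz = trans (^-* z order-K a) (trans (cong (_^ a) (lagrange kz)) (ε^ a))

      ^-≡1 : ∀ a y → 1 + a * order-K ≡ y * n → ∀ {z} → K z → z ^ (y * n) ≡ z
      ^-≡1 a y eq {z} kz = begin
        z ^ (y * n)              ≡⟨ cong (z ^_) (sym eq) ⟩
        z ∙ z ^ (a * order-K)    ≡⟨ cong (z ∙_) (^-multiple-of-order a kz) ⟩
        z ∙ ε                    ≡⟨ identityʳ z ⟩
        z                        ∎

      ^-≡-1 : ∀ a y → 1 + y * n ≡ a * order-K → ∀ {z} → K z → z ^ (y * n) ≡ z ⁻¹
      ^-≡-1 a y eq {z} kz = inverseʳ-unique z _
        (trans (cong (z ^_) eq) (^-multiple-of-order a kz))

    root : El G → El G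
    root z with bézout
    ... | -+ _ y _ = z ^ y
    ... | +- _ y _ = (z ^ y) ⁻¹

    K-root : ∀ {z} → K z → K (root z)
    K-root {z} kz with bézout
    ... | -+ _ y _ = K-^ y kz
    ... | +- _ y _ = K-inv (K-^ y kz)

    root-^ : ∀ {z} → K z → root z ^ n ≡ z
    root-^ {z} kz with bézout
    ... | -+ a y eq = begin
      (z ^ y) ^ n      ≡⟨ sym (^-* z y n) ⟩
      z ^ (n * y)      ≡⟨ cong (z ^_) (*-comm n y) ⟩
      z ^ (y * n)      ≡⟨ ^-≡1 a y eq kz ⟩
      z                ∎
    ... | +- a y eq = begin
      ((z ^ y) ⁻¹) ^ n ≡⟨ ⁻¹-^ n (K-^ y kz) ⟩
      ((z ^ y) ^ n) ⁻¹ ≡⟨ cong _⁻¹ (sym (^-* z y n)) ⟩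
      (z ^ (n * y)) ⁻¹ ≡⟨ cong (λ k → (z ^ k) ⁻¹) (*-comm n y) ⟩
      (z ^ (y * n)) ⁻¹ ≡⟨ cong _⁻¹ (^-≡-1 a y eq kz) ⟩
      (z ⁻¹) ⁻¹        ≡⟨ ⁻¹-involutive z ⟩
      z                ∎

    root-of-^ : ∀ {z} → K z → root (z ^ n) ≡ z
    root-of-^ {z} kz with bézout
    ... | -+ a y eq = trans (sym (^-* z n y)) (^-≡1 a y eq kz)
    ... | +- a y eq = trans (cong _⁻¹ (trans (sym (^-* z n y)) (^-≡-1 a y eq kz))) (⁻¹-involutive z)

    ^-injective : ∀ {a b} → K a → K b → a ^ n ≡ b ^ n → a ≡ b
    ^-injective ka kb e = trans (sym (root-of-^ ka)) (trans (cong root e) (root-of-^ kb))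

  -- Averaging over Γ, possible because |K| is coprime to |Γ|: m-th roots
  -- exist in K for m = |Γ|, and ∏_δ over Γ is invariant under γ·_ .
  module Averaging (coprime : Coprime order-K (FinGroup.size Γ)) where

    m : ℕ
    m = FinGroup.size Γ

    open Roots m coprime public

    root-of-prod : (El Γ → El G) → El G
    root-of-prod d = root (prod d)

    -- H¹(Γ, K) = 0: every crossed homomorphism d : Γ → K for the action
    -- γ · k = conj (σ γ) k is the coboundary of h = (∏_δ d δ)^{1/m},
    -- because u = ∏_δ d δ satisfies u = (d γ)^m · conj (σ γ) u for every γ.
    crossed-hom-coboundary : (σ d : El Γ → El G) → (∀ γ → K (d γ)) →
      (∀ γ δ → d (γ Γ.∙ δ) ≡ d γ ∙ conj (σ γ) (d δ)) →
      K (root-of-prod d) × (∀ γ → d γ ≡ root-of-prod d ∙ conj (σ γ) (root-of-prod d ⁻¹))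
    crossed-hom-coboundary σ d kd crossed = kh , λ γ →
      ^-injective (kd γ) (K-∙ kh (K-conj _ (K-inv kh))) (sym (coboundary-^ γ))
      where
      u = prod d
      ku = K-prod d kd
      h = root u
      kh = K-root ku

      averaged : ∀ γ → u ≡ d γ ^ m ∙ conj (σ γ) u
      averaged γ = begin
        u                                        ≡⟨ prod-permute d kd (Γ.left-mul γ) ⟩
        prod (λ δ → d (γ Γ.∙ δ))                 ≡⟨ prod-cong (crossed γ) ⟩
        prod (λ δ → d γ ∙ conj (σ γ) (d δ))      ≡⟨ prod-mul (λ _ → d γ) _ (λ _ → kd γ) (λ δ → K-conj _ (kd δ)) ⟩
        prod {m} (λ _ → d γ) ∙ prod (λ δ → conj (σ γ) (d δ))
                                                 ≡⟨ cong₂ _∙_ (prod-const m (d γ)) (sym (prod-conj (σ γ) d)) ⟩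
        d γ ^ m ∙ conj (σ γ) u                   ∎

      coboundary-^ : ∀ γ → (h ∙ conj (σ γ) (h ⁻¹)) ^ m ≡ d γ ^ m
      coboundary-^ γ = begin
        (h ∙ conj (σ γ) (h ⁻¹)) ^ m              ≡⟨ ^-distrib m kh (K-conj _ (K-inv kh)) ⟩
        h ^ m ∙ conj (σ γ) (h ⁻¹) ^ m            ≡⟨ cong₂ _∙_ (root-^ ku) (sym (conj-^ (σ γ) (h ⁻¹) m)) ⟩
        u ∙ conj (σ γ) ((h ⁻¹) ^ m)              ≡⟨ cong (λ w → u ∙ conj (σ γ) w) (trans (⁻¹-^ m kh) (cong _⁻¹ (root-^ ku))) ⟩
        u ∙ conj (σ γ) (u ⁻¹)                    ≡⟨ cong₂ _∙_ (averaged γ) (conj-inv (σ γ) u) ⟩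
        (d γ ^ m ∙ conj (σ γ) u) ∙ conj (σ γ) u ⁻¹ ≡⟨ //-rightDividesʳ (conj (σ γ) u) _ ⟩
        d γ ^ m                                  ∎

    -- H²(Γ, K) = 0 (Schur–Zassenhaus): starting from any section t of π,
    -- its factor set f is a coboundary of w γ = (∏_ε f γ ε)^{1/m}, and
    -- σ γ = (w γ)⁻¹ t γ is a section which is a homomorphism.
    module _ (t : El Γ → El G) (πt : ∀ γ → π (t γ) ≡ γ) where

      factor : El Γ → El Γ → El G
      factor γ δ = (t γ ∙ t δ) ∙ t (γ Γ.∙ δ) ⁻¹

      K-factor : ∀ γ δ → K (factor γ δ)
      K-factor γ δ = K-div (trans (π-hom _ _) (trans (cong₂ Γ._∙_ (πt γ) (πt δ)) (sym (πt _))))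

      private
        cancel-middle : ∀ a b c → (a ∙ b ⁻¹) ∙ (b ∙ c) ≡ a ∙ c
        cancel-middle a b c = trans (assoc _ _ _) (cong (a ∙_) (\\-leftDividesʳ b c))

      -- the cocycle identity, from associativity of t γ · t δ · t ε′
      factor-cocycle : ∀ γ δ ε′ →
        factor γ δ ∙ factor (γ Γ.∙ δ) ε′ ≡ conj (t γ) (factor δ ε′) ∙ factor γ (δ Γ.∙ ε′)
      factor-cocycle γ δ ε′ = begin
        factor γ δ ∙ ((t γδ ∙ t ε′) ∙ t[γδ]ε ⁻¹)     ≡⟨ cong (factor γ δ ∙_) (assoc _ _ _) ⟩
        factor γ δ ∙ (t γδ ∙ (t ε′ ∙ t[γδ]ε ⁻¹))     ≡⟨ cancel-middle _ _ _ ⟩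
        (t γ ∙ t δ) ∙ (t ε′ ∙ t[γδ]ε ⁻¹)             ≡⟨ assoc _ _ _ ⟩
        t γ ∙ (t δ ∙ (t ε′ ∙ t[γδ]ε ⁻¹))             ≡⟨ cong (t γ ∙_) (sym (assoc _ _ _)) ⟩
        t γ ∙ ((t δ ∙ t ε′) ∙ t[γδ]ε ⁻¹)             ≡⟨ cong (λ w → t γ ∙ ((t δ ∙ t ε′) ∙ t w ⁻¹)) (Γ.assoc γ δ ε′) ⟩
        t γ ∙ ((t δ ∙ t ε′) ∙ t (γ Γ.∙ δε) ⁻¹)       ≡⟨ cong (t γ ∙_) (sym (cancel-middle _ _ _)) ⟩
        t γ ∙ (factor δ ε′ ∙ (t δε ∙ t (γ Γ.∙ δε) ⁻¹)) ≡⟨ sym (assoc _ _ _) ⟩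
        (t γ ∙ factor δ ε′) ∙ (t δε ∙ t (γ Γ.∙ δε) ⁻¹) ≡⟨ cong (_∙ (t δε ∙ t (γ Γ.∙ δε) ⁻¹)) (conj-shift (t γ) _) ⟩
        (conj (t γ) (factor δ ε′) ∙ t γ) ∙ (t δε ∙ t (γ Γ.∙ δε) ⁻¹) ≡⟨ assoc _ _ _ ⟩
        conj (t γ) (factor δ ε′) ∙ (t γ ∙ (t δε ∙ t (γ Γ.∙ δε) ⁻¹)) ≡⟨ cong (conj (t γ) (factor δ ε′) ∙_) (sym (assoc _ _ _)) ⟩
        conj (t γ) (factor δ ε′) ∙ factor γ δε        ∎
        where
        γδ = γ Γ.∙ δ
        δε = δ Γ.∙ ε′
        t[γδ]ε = t (γδ Γ.∙ ε′)

      average : El Γ → El G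
      average γ = prod (factor γ)

      K-average : ∀ γ → K (average γ)
      K-average γ = K-prod (factor γ) (K-factor γ)

      -- taking the product of the cocycle identity over ε′
      average-cocycle : ∀ γ δ → factor γ δ ^ m ∙ average (γ Γ.∙ δ) ≡ conj (t γ) (average δ) ∙ average γ
      average-cocycle γ δ = begin
        factor γ δ ^ m ∙ average (γ Γ.∙ δ)
          ≡⟨ cong (_∙ average (γ Γ.∙ δ)) (sym (prod-const m (factor γ δ))) ⟩
        prod {m} (λ _ → factor γ δ) ∙ average (γ Γ.∙ δ)
          ≡⟨ sym (prod-mul _ _ (λ _ → K-factor γ δ) (K-factor _)) ⟩
        prod (λ ε′ → factor γ δ ∙ factor (γ Γ.∙ δ) ε′)
          ≡⟨ prod-cong (factor-cocycle γ δ) ⟩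
        prod (λ ε′ → conj (t γ) (factor δ ε′) ∙ factor γ (δ Γ.∙ ε′))
          ≡⟨ prod-mul _ _ (λ ε′ → K-conj _ (K-factor δ ε′)) (λ ε′ → K-factor γ _) ⟩
        prod (λ ε′ → conj (t γ) (factor δ ε′)) ∙ prod (λ ε′ → factor γ (δ Γ.∙ ε′))
          ≡⟨ cong₂ _∙_ (sym (prod-conj (t γ) (factor δ))) (sym (prod-permute (factor γ) (K-factor γ) (Γ.left-mul δ))) ⟩
        conj (t γ) (average δ) ∙ average γ  ∎

      correction : El Γ → El G
      correction γ = root (average γ)

      K-correction : ∀ γ → K (correction γ)
      K-correction γ = K-root (K-average γ)

      -- the factor set is the coboundary of w; after taking m-th powers
      -- (injective on K) this is the averaged cocycle identity
      factor-coboundary : ∀ γ δ →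
        factor γ δ ≡ (conj (t γ) (correction δ) ∙ correction γ) ∙ correction (γ Γ.∙ δ) ⁻¹
      factor-coboundary γ δ = ^-injective (K-factor γ δ) (K-∙ (K-∙ (K-conj _ (kw δ)) (kw γ)) (K-inv (kw _))) (begin
        factor γ δ ^ m
          ≡⟨ sym (//-rightDividesʳ (a (γ Γ.∙ δ)) _) ⟩
        (factor γ δ ^ m ∙ a (γ Γ.∙ δ)) ∙ a (γ Γ.∙ δ) ⁻¹
          ≡⟨ cong (_∙ a (γ Γ.∙ δ) ⁻¹) (average-cocycle γ δ) ⟩
        (conj (t γ) (a δ) ∙ a γ) ∙ a (γ Γ.∙ δ) ⁻¹
          ≡⟨ sym (cong₂ _∙_ (cong₂ _∙_ conj-w^ (root-^ (K-average γ))) w⁻¹^) ⟩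
        (conj (t γ) (w δ) ^ m ∙ w γ ^ m) ∙ (w (γ Γ.∙ δ) ⁻¹) ^ m
          ≡⟨ cong (_∙ (w (γ Γ.∙ δ) ⁻¹) ^ m) (sym (^-distrib m (K-conj _ (kw δ)) (kw γ))) ⟩
        (conj (t γ) (w δ) ∙ w γ) ^ m ∙ (w (γ Γ.∙ δ) ⁻¹) ^ m
          ≡⟨ sym (^-distrib m (K-∙ (K-conj _ (kw δ)) (kw γ)) (K-inv (kw _))) ⟩
        ((conj (t γ) (w δ) ∙ w γ) ∙ w (γ Γ.∙ δ) ⁻¹) ^ m  ∎)
        where
        a = average
        w = correction
        kw = K-correction
        conj-w^ : conj (t γ) (w δ) ^ m ≡ conj (t γ) (a δ)
        conj-w^ = trans (sym (conj-^ (t γ) (w δ) m)) (cong (conj (t γ)) (root-^ (K-average δ)))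
        w⁻¹^ : (w (γ Γ.∙ δ) ⁻¹) ^ m ≡ a (γ Γ.∙ δ) ⁻¹
        w⁻¹^ = trans (⁻¹-^ m (kw _)) (cong _⁻¹ (root-^ (K-average _)))

      splitting : Σ (El Γ → El G) λ σ → (∀ γ → π (σ γ) ≡ γ) × IsHom Γ G σ
      splitting = σ , πσ , σ-hom
        where
        w = correction
        σ : El Γ → El G
        σ γ = w γ ⁻¹ ∙ t γ

        πσ : ∀ γ → π (σ γ) ≡ γ
        πσ γ = trans (π-hom _ _) (trans (cong₂ Γ._∙_ (K-inv (K-correction γ)) (πt γ)) (Γ.identityˡ γ))

        σ-hom : IsHom Γ G σ
        σ-hom γ δ = sym (begin
          (w γ ⁻¹ ∙ t γ) ∙ (w δ ⁻¹ ∙ t δ)                 ≡⟨ assoc _ _ _ ⟩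
          w γ ⁻¹ ∙ (t γ ∙ (w δ ⁻¹ ∙ t δ))                 ≡⟨ cong (w γ ⁻¹ ∙_) (sym (assoc _ _ _)) ⟩
          w γ ⁻¹ ∙ ((t γ ∙ w δ ⁻¹) ∙ t δ)                 ≡⟨ cong (λ x → w γ ⁻¹ ∙ (x ∙ t δ)) (conj-shift (t γ) (w δ ⁻¹)) ⟩
          w γ ⁻¹ ∙ ((conj (t γ) (w δ ⁻¹) ∙ t γ) ∙ t δ)    ≡⟨ cong (λ x → w γ ⁻¹ ∙ ((x ∙ t γ) ∙ t δ)) (conj-inv (t γ) (w δ)) ⟩
          w γ ⁻¹ ∙ ((c ⁻¹ ∙ t γ) ∙ t δ)                   ≡⟨ cong (w γ ⁻¹ ∙_) (assoc _ _ _) ⟩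
          w γ ⁻¹ ∙ (c ⁻¹ ∙ (t γ ∙ t δ))                   ≡⟨ sym (assoc _ _ _) ⟩
          (w γ ⁻¹ ∙ c ⁻¹) ∙ (t γ ∙ t δ)                   ≡⟨ cong₂ _∙_ (sym (⁻¹-anti-homo-∙ c (w γ))) (sym (//-rightDividesˡ (t (γ Γ.∙ δ)) _)) ⟩
          (c ∙ w γ) ⁻¹ ∙ (factor γ δ ∙ t (γ Γ.∙ δ))       ≡⟨ cong (λ x → (c ∙ w γ) ⁻¹ ∙ (x ∙ t (γ Γ.∙ δ))) (factor-coboundary γ δ) ⟩
          (c ∙ w γ) ⁻¹ ∙ (((c ∙ w γ) ∙ w (γ Γ.∙ δ) ⁻¹) ∙ t (γ Γ.∙ δ)) ≡⟨ cong ((c ∙ w γ) ⁻¹ ∙_) (assoc _ _ _) ⟩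
          (c ∙ w γ) ⁻¹ ∙ ((c ∙ w γ) ∙ σ (γ Γ.∙ δ))        ≡⟨ \\-leftDividesʳ (c ∙ w γ) _ ⟩
          σ (γ Γ.∙ δ)                                     ∎)
          where c = conj (t γ) (w δ)

  -- H¹(C₂, K) = 0 for |K| odd: two involutions with the same image in Γ
  -- are conjugate by an element of K.  With d = b a⁻¹ ∈ K one has
  -- conj a (d⁻¹) = d, so the square root h of d satisfies h · conj a (h⁻¹) = d,
  -- and then conj h a = d a = b.
  involutions-conjugate : Coprime order-K 2 → ∀ {a b} → a ∙ a ≡ ε → b ∙ b ≡ ε → π b ≡ π a →
    Σ (El G) λ h → K h × conj h a ≡ b
  involutions-conjugate coprime {a} {b} aa bb πb≡πa = h , kh , (begin
    (h ∙ a) ∙ h ⁻¹          ≡⟨ assoc _ _ _ ⟩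
    h ∙ (a ∙ h ⁻¹)          ≡⟨ cong (h ∙_) (conj-shift a (h ⁻¹)) ⟩
    h ∙ (conj a (h ⁻¹) ∙ a) ≡⟨ sym (assoc _ _ _) ⟩
    (h ∙ conj a (h ⁻¹)) ∙ a ≡⟨ cong (_∙ a) h-coboundary ⟩
    (b ∙ a ⁻¹) ∙ a          ≡⟨ //-rightDividesˡ a b ⟩
    b                       ∎)
    where
    open Roots 2 coprime
    d = b ∙ a ⁻¹
    kd : K d
    kd = K-div πb≡πa
    h = root d
    kh = K-root kd

    self-inverse : ∀ {x} → x ∙ x ≡ ε → x ⁻¹ ≡ x
    self-inverse {x} xx = sym (inverseʳ-unique x x xx)

    conj-d⁻¹ : conj a (d ⁻¹) ≡ d
    conj-d⁻¹ = begin
      (a ∙ (b ∙ a ⁻¹) ⁻¹) ∙ a ⁻¹   ≡⟨ cong (λ x → (a ∙ x) ∙ a ⁻¹) (⁻¹-anti-homo-∙ b (a ⁻¹)) ⟩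
      (a ∙ (a ⁻¹ ⁻¹ ∙ b ⁻¹)) ∙ a ⁻¹ ≡⟨ cong (λ x → (a ∙ (x ⁻¹ ∙ b ⁻¹)) ∙ a ⁻¹) (self-inverse aa) ⟩
      (a ∙ (a ⁻¹ ∙ b ⁻¹)) ∙ a ⁻¹    ≡⟨ cong (_∙ a ⁻¹) (\\-leftDividesˡ a (b ⁻¹)) ⟩
      b ⁻¹ ∙ a ⁻¹                  ≡⟨ cong (_∙ a ⁻¹) (self-inverse bb) ⟩
      d                            ∎

    h-coboundary : h ∙ conj a (h ⁻¹) ≡ d
    h-coboundary = ^-injective (K-∙ kh (K-conj a (K-inv kh))) kd (begin
      (h ∙ conj a (h ⁻¹)) ^ 2     ≡⟨ ^-distrib 2 kh (K-conj a (K-inv kh)) ⟩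
      h ^ 2 ∙ conj a (h ⁻¹) ^ 2   ≡⟨ cong₂ _∙_ (root-^ kd) (sym (conj-^ a (h ⁻¹) 2)) ⟩
      d ∙ conj a ((h ⁻¹) ^ 2)     ≡⟨ cong (λ x → d ∙ conj a x) (trans (⁻¹-^ 2 kh) (cong _⁻¹ (root-^ kd))) ⟩
      d ∙ conj a (d ⁻¹)           ≡⟨ cong (d ∙_) (trans conj-d⁻¹ (sym (identityʳ d))) ⟩
      d ^ 2                       ∎)

ι : El GalCR
ι = Fin.suc Fin.zero

-- Schur–Zassenhaus gives a homomorphic section σ₀;
-- if s ι ≠ ε then Γ has even order, so |K| is odd, and the involutions
-- σ₀ (s ι) and c ι are conjugate by some h ∈ K; take σ = conj h ∘ σ₀.
module TripleSplitting (Γ : FinGroup) (s : El GalCR → El Γ) (s-hom : IsHom GalCR Γ s)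
    (T : ClassTriple Γ s) where

  open import Data.Fin using (zero; suc)
  open import Data.Fin.Properties using (_≟_)
  open import Data.Nat.Divisibility using (∣-trans)
  open import Data.Product using (proj₁; proj₂)
  open import Relation.Nullary using (Dec; yes; no; ¬_)
  open import Relation.Binary.PropositionalEquality

  open ClassTriple T public
  open AbelianKernel G Γ π π-hom ker-abelian public
  open Averaging ker-coprime using (splitting)
  open Hom {GalCR} {Γ} s s-hom using () renaming (hom-ε to s-ε)
  open Hom {GalCR} {G} c c-hom using () renaming (hom-ε to c-ε)
  open ≡-Reasoning

  record Compatible (σ : El Γ → El G) : Set where
    field
      π∘σ : ∀ γ → π (σ γ) ≡ γ
      σ-hom : IsHom Γ G σ
      σ∘s : ∀ x → σ (s x) ≡ c x

  private
    σ-ε : ∀ σ → IsHom Γ G σ → σ Γ.ε ≡ ε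
    σ-ε σ = Hom.hom-ε {Γ} {G} σ

    -- when s is trivial, every homomorphic section extends c (by (iv))
    extends-c-trivially : ∀ σ → IsHom Γ G σ → s ι ≡ Γ.ε → ∀ x → σ (s x) ≡ c x
    extends-c-trivially σ σ-hom sι≡ε zero = trans (cong σ s-ε) (trans (σ-ε σ σ-hom) (sym c-ε))
    extends-c-trivially σ σ-hom sι≡ε (suc zero) =
      trans (cong σ sι≡ε) (trans (σ-ε σ σ-hom) (sym (imc∩ker ι (trans (π∘c≡s ι) sι≡ε))))

    -- |K| is odd as soon as Γ contains the involution s ι
    order-K-odd : ¬ s ι ≡ Γ.ε → Coprime order-K 2
    order-K-odd sι≢ε (i∣|K| , i∣2) =
      ker-coprime (i∣|K| , ∣-trans i∣2 (Parity.involution⇒even Γ (s ι) sι≢ε (trans (sym (s-hom ι ι)) s-ε)))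

    conj-section : ∀ {h σ} → K h → (∀ γ → π (σ γ) ≡ γ) → IsHom Γ G σ →
      (∀ γ → π (conj h (σ γ)) ≡ γ) × IsHom Γ G (λ γ → conj h (σ γ))
    conj-section {h} {σ} kh π∘σ σ-hom =
      (λ γ → trans (π-conj-K _ kh) (π∘σ γ)) ,
      (λ γ δ → trans (cong (conj h) (σ-hom γ δ)) (conj-hom h _ _))

    schur-zassenhaus : Σ (El Γ → El G) λ σ → (∀ γ → π (σ γ) ≡ γ) × IsHom Γ G σ
    schur-zassenhaus = splitting (λ γ → proj₁ (π-surj γ)) (λ γ → proj₂ (π-surj γ))

    σ₀ : El Γ → El G
    σ₀ = proj₁ schur-zassenhaus

    π∘σ₀ : ∀ γ → π (σ₀ γ) ≡ γ
    π∘σ₀ = proj₁ (proj₂ schur-zassenhaus)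

    σ₀-hom : IsHom Γ G σ₀
    σ₀-hom = proj₂ (proj₂ schur-zassenhaus)

    σ₀sι-involution : σ₀ (s ι) ∙ σ₀ (s ι) ≡ ε
    σ₀sι-involution = begin
      σ₀ (s ι) ∙ σ₀ (s ι)   ≡⟨ sym (σ₀-hom (s ι) (s ι)) ⟩
      σ₀ (s ι Γ.∙ s ι)      ≡⟨ cong σ₀ (sym (s-hom ι ι)) ⟩
      σ₀ (s zero)           ≡⟨ cong σ₀ s-ε ⟩
      σ₀ Γ.ε                ≡⟨ σ-ε σ₀ σ₀-hom ⟩
      ε                     ∎

    adjust : Dec (s ι ≡ Γ.ε) → Σ (El Γ → El G) Compatible
    adjust (yes sι≡ε) = σ₀ , record
      { π∘σ = π∘σ₀ ; σ-hom = σ₀-hom ; σ∘s = extends-c-trivially σ₀ σ₀-hom sι≡ε }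
    adjust (no sι≢ε) = σ , record
      { π∘σ = proj₁ (conj-section kh π∘σ₀ σ₀-hom) ; σ-hom = proj₂ (conj-section kh π∘σ₀ σ₀-hom) ; σ∘s = σ∘s }
      where
      conjugate : Σ (El G) λ h → K h × conj h (σ₀ (s ι)) ≡ c ι
      conjugate = involutions-conjugate (order-K-odd sι≢ε) σ₀sι-involution
        (trans (sym (c-hom ι ι)) c-ε) (trans (π∘c≡s ι) (sym (π∘σ₀ (s ι))))
      h = proj₁ conjugate
      kh = proj₁ (proj₂ conjugate)
      σ : El Γ → El G
      σ γ = conj h (σ₀ γ)
      σ∘s : ∀ x → σ (s x) ≡ c x
      σ∘s zero = trans (cong σ s-ε) (trans (cong (conj h) (σ-ε σ₀ σ₀-hom)) (trans (conj-ε h) (sym c-ε)))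
      σ∘s (suc zero) = proj₂ (proj₂ conjugate)

  compatible-splitting : Σ (El Γ → El G) Compatible
  compatible-splitting = adjust (s ι ≟ Γ.ε)

-- Fixing a compatible splitting σ, every g ∈ G factors uniquely as
-- g = κ g · σ (π g) with κ g ∈ K; conjugation by g acts on K as
-- conjugation by σ (π g), and the only element of K fixed by all of
-- σ Γ is ε.
module Decomposition (Γ : FinGroup) (s : El GalCR → El Γ) (s-hom : IsHom GalCR Γ s)
    (T : ClassTriple Γ s) where

  open import Data.Product using (proj₁; proj₂)
  open import Relation.Binary.PropositionalEquality

  open TripleSplitting Γ s s-hom T public
  open ≡-Reasoning

  σ : El Γ → El G
  σ = proj₁ compatible-splitting

  open Compatible (proj₂ compatible-splitting) public

  σ-ε : σ Γ.ε ≡ ε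
  σ-ε = Hom.hom-ε {Γ} {G} σ σ-hom

  κ : El G → El G
  κ g = g ∙ σ (π g) ⁻¹

  K-κ : ∀ g → K (κ g)
  K-κ g = K-div (sym (π∘σ (π g)))

  κ-factor : ∀ g → κ g ∙ σ (π g) ≡ g
  κ-factor g = //-rightDividesˡ (σ (π g)) g

  κ-K : ∀ {x} → K x → κ x ≡ x
  κ-K {x} kx = begin
    x ∙ σ (π x) ⁻¹   ≡⟨ cong (λ γ → x ∙ σ γ ⁻¹) kx ⟩
    x ∙ σ Γ.ε ⁻¹     ≡⟨ cong (λ y → x ∙ y ⁻¹) σ-ε ⟩
    x ∙ ε ⁻¹         ≡⟨ cong (x ∙_) ε⁻¹≈ε ⟩
    x ∙ ε            ≡⟨ identityʳ x ⟩
    x                ∎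

  κ-σ : ∀ γ → κ (σ γ) ≡ ε
  κ-σ γ = trans (cong (λ δ → σ γ ∙ σ δ ⁻¹) (π∘σ γ)) (inverseʳ (σ γ))

  π-kσ : ∀ {k} γ → K k → π (k ∙ σ γ) ≡ γ
  π-kσ {k} γ kk = trans (π-hom _ _) (trans (cong₂ Γ._∙_ kk (π∘σ γ)) (Γ.identityˡ γ))

  κ-kσ : ∀ {k} γ → K k → κ (k ∙ σ γ) ≡ k
  κ-kσ {k} γ kk = trans (cong (λ δ → (k ∙ σ γ) ∙ σ δ ⁻¹) (π-kσ γ kk)) (//-rightDividesʳ (σ γ) k)

  κ-c : ∀ x → κ (c x) ≡ ε
  κ-c x = trans (cong (λ γ → c x ∙ σ γ ⁻¹) (π∘c≡s x)) (trans (cong (λ y → c x ∙ y ⁻¹) (σ∘s x)) (inverseʳ (c x)))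

  κ-mul : ∀ x y → κ (x ∙ y) ≡ κ x ∙ conj (σ (π x)) (κ y)
  κ-mul x y = sym (begin
    (x ∙ σx ⁻¹) ∙ ((σx ∙ (y ∙ σy ⁻¹)) ∙ σx ⁻¹) ≡⟨ cong ((x ∙ σx ⁻¹) ∙_) (assoc _ _ _) ⟩
    (x ∙ σx ⁻¹) ∙ (σx ∙ ((y ∙ σy ⁻¹) ∙ σx ⁻¹)) ≡⟨ assoc _ _ _ ⟩
    x ∙ (σx ⁻¹ ∙ (σx ∙ ((y ∙ σy ⁻¹) ∙ σx ⁻¹))) ≡⟨ cong (x ∙_) (\\-leftDividesʳ σx _) ⟩
    x ∙ ((y ∙ σy ⁻¹) ∙ σx ⁻¹)                   ≡⟨ sym (assoc _ _ _) ⟩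
    (x ∙ (y ∙ σy ⁻¹)) ∙ σx ⁻¹                   ≡⟨ cong (_∙ σx ⁻¹) (sym (assoc _ _ _)) ⟩
    ((x ∙ y) ∙ σy ⁻¹) ∙ σx ⁻¹                   ≡⟨ assoc _ _ _ ⟩
    (x ∙ y) ∙ (σy ⁻¹ ∙ σx ⁻¹)                   ≡⟨ cong ((x ∙ y) ∙_) (sym (⁻¹-anti-homo-∙ σx σy)) ⟩
    (x ∙ y) ∙ (σx ∙ σy) ⁻¹                      ≡⟨ cong (λ z → (x ∙ y) ∙ z ⁻¹) (sym (σ-hom (π x) (π y))) ⟩
    (x ∙ y) ∙ σ (π x Γ.∙ π y) ⁻¹                ≡⟨ cong (λ γ → (x ∙ y) ∙ σ γ ⁻¹) (sym (π-hom x y)) ⟩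
    κ (x ∙ y)                                   ∎)
    where σx = σ (π x)
          σy = σ (π y)

  conj-via-σ : ∀ g {x} → K x → conj g x ≡ conj (σ (π g)) x
  conj-via-σ g {x} kx = begin
    conj g x                         ≡⟨ cong (λ y → conj y x) (sym (κ-factor g)) ⟩
    conj (κ g ∙ σ (π g)) x           ≡⟨ sym (conj-comp _ _ x) ⟩
    conj (κ g) (conj (σ (π g)) x)    ≡⟨ K-conj-K (K-κ g) (K-conj _ kx) ⟩
    conj (σ (π g)) x                 ∎

  K-fixed-trivial : ∀ {k} → K k → (∀ γ → conj (σ γ) k ≡ k) → k ≡ ε
  K-fixed-trivial {k} kk fixed = ker-fix-trivial k kk (λ γ g _ → trans (conj-via-σ g kk) (fixed (π g)))

  K-conjugator-unique : ∀ {h h′} → K h → K h′ → (∀ γ → conj h (σ γ) ≡ conj h′ (σ γ)) → h ≡ h′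
  K-conjugator-unique {h} {h′} kh kh′ same = begin
    h                ≡⟨ sym (\\-leftDividesˡ h′ h) ⟩
    h′ ∙ (h′ ⁻¹ ∙ h) ≡⟨ cong (h′ ∙_) (K-fixed-trivial (K-∙ (K-inv kh′) kh) fixes) ⟩
    h′ ∙ ε           ≡⟨ identityʳ h′ ⟩
    h′               ∎
    where
    z = h′ ⁻¹ ∙ h
    z-fixes-σ : ∀ γ → conj z (σ γ) ≡ σ γ
    z-fixes-σ γ = begin
      conj z (σ γ)                   ≡⟨ sym (conj-comp _ _ _) ⟩
      conj (h′ ⁻¹) (conj h (σ γ))    ≡⟨ cong (conj (h′ ⁻¹)) (same γ) ⟩
      conj (h′ ⁻¹) (conj h′ (σ γ))   ≡⟨ conj-comp _ _ _ ⟩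
      conj (h′ ⁻¹ ∙ h′) (σ γ)        ≡⟨ cong (λ y → conj y (σ γ)) (inverseˡ h′) ⟩
      conj ε (σ γ)                   ≡⟨ conj-by-ε _ ⟩
      σ γ                            ∎
    fixes : ∀ γ → conj (σ γ) z ≡ z
    fixes γ = conj-fixed-sym z (σ γ) (z-fixes-σ γ)

  -- This builds automorphisms (H = G) as well as
  -- isomorphisms between class triples.
  module Glue (H : FinGroup) (θ : El G → El H) (ρ : El Γ → El H) where

    private module H = GroupFacts H

    glue : El G → El H
    glue g = θ (κ g) H.∙ ρ (π g)

    Multiplicative : Set
    Multiplicative = ∀ {k l} → K k → K l → θ (k ∙ l) ≡ θ k H.∙ θ l

    Equivariant : Set
    Equivariant = ∀ γ {k} → K k → θ (conj (σ γ) k) ≡ H.conj (ρ γ) (θ k)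

    θ-ε : Multiplicative → θ ε ≡ H.ε
    θ-ε θ-hom = H.identityʳ-unique (θ ε) (θ ε) (trans (sym (θ-hom K-ε K-ε)) (cong θ (identityˡ ε)))

    glue-hom : IsHom Γ H ρ → Multiplicative → Equivariant → IsHom G H glue
    glue-hom ρ-hom θ-hom θ-equivariant x y = begin
      θ (κ (x ∙ y)) H.∙ ρ (π (x ∙ y))
        ≡⟨ cong₂ H._∙_ (cong θ (κ-mul x y)) (trans (cong ρ (π-hom x y)) (ρ-hom _ _)) ⟩
      θ (κ x ∙ conj (σ (π x)) (κ y)) H.∙ (ρx H.∙ ρy)
        ≡⟨ cong (H._∙ (ρx H.∙ ρy)) (θ-hom (K-κ x) (K-conj _ (K-κ y))) ⟩
      (a H.∙ θ (conj (σ (π x)) (κ y))) H.∙ (ρx H.∙ ρy)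
        ≡⟨ cong (λ z → (a H.∙ z) H.∙ (ρx H.∙ ρy)) (θ-equivariant (π x) (K-κ y)) ⟩
      (a H.∙ H.conj ρx b) H.∙ (ρx H.∙ ρy)   ≡⟨ H.assoc _ _ _ ⟩
      a H.∙ (H.conj ρx b H.∙ (ρx H.∙ ρy))   ≡⟨ cong (a H.∙_) (sym (H.assoc _ _ _)) ⟩
      a H.∙ ((H.conj ρx b H.∙ ρx) H.∙ ρy)   ≡⟨ cong (λ z → a H.∙ (z H.∙ ρy)) (sym (H.conj-shift ρx b)) ⟩
      a H.∙ ((ρx H.∙ b) H.∙ ρy)             ≡⟨ cong (a H.∙_) (H.assoc _ _ _) ⟩
      a H.∙ (ρx H.∙ (b H.∙ ρy))             ≡⟨ sym (H.assoc _ _ _) ⟩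
      (a H.∙ ρx) H.∙ (b H.∙ ρy)             ∎
      where ρx = ρ (π x)
            ρy = ρ (π y)
            a = θ (κ x)
            b = θ (κ y)

    glue-c : Multiplicative → ∀ {c′ : El GalCR → El H} → (∀ x → ρ (s x) ≡ c′ x) → ∀ x → glue (c x) ≡ c′ x
    glue-c θ-hom {c′} ρ∘s x = begin
      θ (κ (c x)) H.∙ ρ (π (c x))  ≡⟨ cong₂ H._∙_ (trans (cong θ (κ-c x)) (θ-ε θ-hom)) (cong ρ (π∘c≡s x)) ⟩
      H.ε H.∙ ρ (s x)              ≡⟨ H.identityˡ _ ⟩
      ρ (s x)                      ≡⟨ ρ∘s x ⟩
      c′ x                         ∎

-- A pair (h, α) assembles
-- to the automorphism g ↦ conj h (α (κ g) · σ (π g)).  Conversely an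
-- automorphism τ fixes π, so γ ↦ τ (σ γ) σ(γ)⁻¹ is a crossed homomorphism
-- Γ → K, the coboundary of some h ∈ K (fixed by im c, as τ fixes c);
-- with α = τ on K this recovers τ, and h is unique by condition (iii).
module Automorphisms (Γ : FinGroup) (s : El GalCR → El Γ) (s-hom : IsHom GalCR Γ s)
    (T : ClassTriple Γ s) where

  open import Data.Fin.Properties using (_≟_)
  open import Data.Product using (∃; proj₁; proj₂)
  open import Data.Bool using (if_then_else_)
  open import Data.Empty using (⊥-elim)
  open import Relation.Nullary using (yes; no; does; ¬_)
  open import Relation.Binary.PropositionalEquality
  open Counting using (Decomposes; countFun-decomposes)

  open Decomposition Γ s s-hom T
  open Averaging ker-coprime using (root; root-of-prod; crossed-hom-coboundary)
  open ≡-Reasoning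

  assemble : El G → (El G → El G) → El G → El G
  assemble h α g = conj h (Glue.glue G α σ g)

  module _ {h α} (fixed : IsFixedIms Γ T h) (autΓ : IsAutΓ Γ T α) where
    private
      kh = proj₁ fixed
      α-K = proj₁ (proj₂ autΓ)
      α-hom = proj₁ (proj₂ (proj₂ autΓ))
      α-injective = proj₁ (proj₂ (proj₂ (proj₂ autΓ)))
      α-surjective = proj₁ (proj₂ (proj₂ (proj₂ (proj₂ autΓ))))
      α-equivariant = proj₂ (proj₂ (proj₂ (proj₂ (proj₂ autΓ))))
      open Glue G α σ

    assemble-π : ∀ x → π (assemble h α x) ≡ π x
    assemble-π x = trans (π-conj-K _ kh) (π-kσ (π x) (α-K (κ x) (K-κ x)))

    assemble-hom : IsHom G G (assemble h α)
    assemble-hom x y = trans (cong (conj h) (glue-hom σ-hom (α-hom _ _) (λ γ → α-equivariant (σ γ) _) x y))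
                             (conj-hom h _ _)

    assemble-c : ∀ x → assemble h α (c x) ≡ c x
    assemble-c x = trans (cong (conj h) (glue-c (α-hom _ _) σ∘s x))
                         (conj-fixed-sym (c x) h (proj₂ fixed x (c x) (π∘c≡s x)))

    assemble-injective : ∀ x y → assemble h α x ≡ assemble h α y → x ≡ y
    assemble-injective x y e = begin
      x                    ≡⟨ sym (κ-factor x) ⟩
      κ x ∙ σ (π x)        ≡⟨ cong₂ _∙_ same-κ (cong σ same-π) ⟩
      κ y ∙ σ (π y)        ≡⟨ κ-factor y ⟩
      y                    ∎
      where
      same-π : π x ≡ π y
      same-π = trans (sym (assemble-π x)) (trans (cong π e) (assemble-π y))
      same-κ : κ x ≡ κ y
      same-κ = α-injective _ _ (K-κ x) (K-κ y) (∙-cancelʳ (σ (π x)) _ _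
        (trans (conj-injective h e) (cong (λ γ → α (κ y) ∙ σ γ) (sym same-π))))

    assemble-surjective : ∀ y → ∃ λ x → assemble h α x ≡ y
    assemble-surjective y = k ∙ σ (π y′) , (begin
      conj h (α (κ (k ∙ σ (π y′))) ∙ σ (π (k ∙ σ (π y′))))
        ≡⟨ cong₂ (λ a γ → conj h (α a ∙ σ γ)) (κ-kσ (π y′) kk) (π-kσ (π y′) kk) ⟩
      conj h (α k ∙ σ (π y′))        ≡⟨ cong (λ z → conj h (z ∙ σ (π y′))) αk≡κy′ ⟩
      conj h (κ y′ ∙ σ (π y′))       ≡⟨ cong (conj h) (κ-factor y′) ⟩
      conj h (conj (h ⁻¹) y)         ≡⟨ conj-comp _ _ _ ⟩
      conj (h ∙ h ⁻¹) y              ≡⟨ cong (λ z → conj z y) (inverseʳ h) ⟩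
      conj ε y                       ≡⟨ conj-by-ε y ⟩
      y                              ∎)
      where
      y′ = conj (h ⁻¹) y
      preimage = α-surjective (κ y′) (K-κ y′)
      k = proj₁ preimage
      kk = proj₁ (proj₂ preimage)
      αk≡κy′ = proj₂ (proj₂ preimage)

    assemble-aut : IsAut Γ T (assemble h α)
    assemble-aut = assemble-hom , assemble-π , assemble-c , assemble-injective , assemble-surjective

  displacement : (El G → El G) → El Γ → El G
  displacement τ γ = τ (σ γ) ∙ σ γ ⁻¹

  conjugator : (El G → El G) → El G
  conjugator τ = root-of-prod (displacement τ)

  restriction : (El G → El G) → El G → El G
  restriction τ x = if does (π x ≟ Γ.ε) then τ x else x

  conjugator-cong : ∀ {τ τ′} → (∀ x → τ x ≡ τ′ x) → conjugator τ ≡ conjugator τ′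
  conjugator-cong e = cong root (prod-cong (λ γ → cong (_∙ σ γ ⁻¹) (e (σ γ))))

  restriction-K : ∀ τ {x} → K x → restriction τ x ≡ τ x
  restriction-K τ {x} kx with π x ≟ Γ.ε
  ... | yes _ = refl
  ... | no ¬kx = ⊥-elim (¬kx kx)

  restriction-¬K : ∀ τ {x} → ¬ K x → restriction τ x ≡ x
  restriction-¬K τ {x} ¬kx with π x ≟ Γ.ε
  ... | yes kx = ⊥-elim (¬kx kx)
  ... | no _ = refl

  restriction-cong : ∀ {τ τ′} → (∀ x → τ x ≡ τ′ x) → ∀ x → restriction τ x ≡ restriction τ′ x
  restriction-cong e x with π x ≟ Γ.ε
  ... | yes _ = e x
  ... | no _ = refl

  module _ {τ} (τ-hom : IsHom G G τ) (π∘τ : ∀ x → π (τ x) ≡ π x) where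

    displacement-crossed : ∀ γ δ → displacement τ (γ Γ.∙ δ) ≡ displacement τ γ ∙ conj (σ γ) (displacement τ δ)
    displacement-crossed γ δ = sym (begin
      (a ∙ σγ ⁻¹) ∙ ((σγ ∙ (b ∙ σδ ⁻¹)) ∙ σγ ⁻¹) ≡⟨ cong ((a ∙ σγ ⁻¹) ∙_) (assoc _ _ _) ⟩
      (a ∙ σγ ⁻¹) ∙ (σγ ∙ ((b ∙ σδ ⁻¹) ∙ σγ ⁻¹)) ≡⟨ assoc _ _ _ ⟩
      a ∙ (σγ ⁻¹ ∙ (σγ ∙ ((b ∙ σδ ⁻¹) ∙ σγ ⁻¹))) ≡⟨ cong (a ∙_) (\\-leftDividesʳ σγ _) ⟩
      a ∙ ((b ∙ σδ ⁻¹) ∙ σγ ⁻¹)                   ≡⟨ cong (a ∙_) (assoc _ _ _) ⟩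
      a ∙ (b ∙ (σδ ⁻¹ ∙ σγ ⁻¹))                   ≡⟨ sym (assoc _ _ _) ⟩
      (a ∙ b) ∙ (σδ ⁻¹ ∙ σγ ⁻¹)                   ≡⟨ cong₂ _∙_ (sym (τ-hom _ _)) (sym (⁻¹-anti-homo-∙ σγ σδ)) ⟩
      τ (σγ ∙ σδ) ∙ (σγ ∙ σδ) ⁻¹                  ≡⟨ cong (λ z → τ z ∙ z ⁻¹) (sym (σ-hom γ δ)) ⟩
      displacement τ (γ Γ.∙ δ)                    ∎)
      where σγ = σ γ
            σδ = σ δ
            a = τ σγ
            b = τ σδ

    -- ... hence a coboundary: τ acts on σ Γ as conjugation by an element of K
    conjugator-spec : K (conjugator τ) × (∀ γ → τ (σ γ) ≡ conj (conjugator τ) (σ γ))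
    conjugator-spec = kh , λ γ → begin
      τ (σ γ)                                 ≡⟨ sym (//-rightDividesˡ (σ γ) _) ⟩
      displacement τ γ ∙ σ γ                  ≡⟨ cong (_∙ σ γ) (coboundary γ) ⟩
      (h ∙ conj (σ γ) (h ⁻¹)) ∙ σ γ           ≡⟨ assoc _ _ _ ⟩
      h ∙ (conj (σ γ) (h ⁻¹) ∙ σ γ)           ≡⟨ cong (h ∙_) (//-rightDividesˡ (σ γ) _) ⟩
      h ∙ (σ γ ∙ h ⁻¹)                        ≡⟨ sym (assoc _ _ _) ⟩
      conj h (σ γ)                            ∎
      where
      h = conjugator τ
      spec = crossed-hom-coboundary σ (displacement τ) (λ γ → K-div (π∘τ (σ γ))) displacement-crossed
      kh = proj₁ spec
      coboundary = proj₂ spec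

    assemble-parts : ∀ x → assemble (conjugator τ) (restriction τ) x ≡ τ x
    assemble-parts x = begin
      conj h (restriction τ (κ x) ∙ σ (π x))  ≡⟨ cong (λ z → conj h (z ∙ σ (π x))) (restriction-K τ (K-κ x)) ⟩
      conj h (τ (κ x) ∙ σ (π x))              ≡⟨ conj-hom h _ _ ⟩
      conj h (τ (κ x)) ∙ conj h (σ (π x))     ≡⟨ cong₂ _∙_ (K-conj-K kh (trans (π∘τ _) (K-κ x))) (sym (proj₂ conjugator-spec (π x))) ⟩
      τ (κ x) ∙ τ (σ (π x))                   ≡⟨ sym (τ-hom _ _) ⟩
      τ (κ x ∙ σ (π x))                       ≡⟨ cong τ (κ-factor x) ⟩
      τ x                                     ∎
      where
      h = conjugator τ
      kh = proj₁ conjugator-spec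

  module _ {τ} (aut : IsAut Γ T τ) where
    private
      τ-hom = proj₁ aut
      π∘τ = proj₁ (proj₂ aut)
      τ∘c = proj₁ (proj₂ (proj₂ aut))
      τ-injective = proj₁ (proj₂ (proj₂ (proj₂ aut)))
      τ-surjective = proj₂ (proj₂ (proj₂ (proj₂ aut)))
      spec = conjugator-spec τ-hom π∘τ
      h = conjugator τ
      kh = proj₁ spec
      K-τ : ∀ {k} → K k → K (τ k)
      K-τ {k} kk = trans (π∘τ k) kk

    -- the conjugator lies in (ker π)^{im s}: conj (c x) fixes it since τ fixes c x
    conjugator-fixed : IsFixedIms Γ T h
    conjugator-fixed = kh , λ x g πg≡sx → begin
      conj g h              ≡⟨ conj-via-σ g kh ⟩
      conj (σ (π g)) h      ≡⟨ cong (λ γ → conj γ h) (trans (cong σ πg≡sx) (σ∘s x)) ⟩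
      conj (c x) h          ≡⟨ conj-fixed-sym h (c x) (h-fixes-c x) ⟩
      h                     ∎
      where
      h-fixes-c : ∀ x → conj h (c x) ≡ c x
      h-fixes-c x = begin
        conj h (c x)        ≡⟨ cong (conj h) (sym (σ∘s x)) ⟩
        conj h (σ (s x))    ≡⟨ sym (proj₂ spec (s x)) ⟩
        τ (σ (s x))         ≡⟨ cong τ (σ∘s x) ⟩
        τ (c x)             ≡⟨ τ∘c x ⟩
        c x                 ∎

    restriction-autΓ : IsAutΓ Γ T (restriction τ)
    restriction-autΓ =
      (λ x ¬kx → restriction-¬K τ ¬kx) ,
      (λ k kk → subst K (sym (restriction-K τ kk)) (K-τ kk)) ,
      (λ k l kk kl → trans (restriction-K τ (K-∙ kk kl))
                       (trans (τ-hom k l) (sym (cong₂ _∙_ (restriction-K τ kk) (restriction-K τ kl))))) ,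
      (λ k l kk kl e → τ-injective k l (trans (sym (restriction-K τ kk)) (trans e (restriction-K τ kl)))) ,
      surjective ,
      equivariant
      where
      surjective : ∀ l → K l → ∃ λ k → K k × restriction τ k ≡ l
      surjective l kl = x , kx , trans (restriction-K τ kx) τx≡l
        where
        x = proj₁ (τ-surjective l)
        τx≡l = proj₂ (τ-surjective l)
        kx : K x
        kx = trans (sym (π∘τ x)) (trans (cong π τx≡l) kl)
      equivariant : ∀ g k → K k → restriction τ (conj g k) ≡ conj g (restriction τ k)
      equivariant g k kk = begin
        restriction τ (conj g k)   ≡⟨ restriction-K τ (K-conj g kk) ⟩
        τ (conj g k)               ≡⟨ Hom.hom-conj {G} {G} τ τ-hom g k ⟩
        conj (τ g) (τ k)           ≡⟨ conj-via-σ (τ g) (K-τ kk) ⟩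
        conj (σ (π (τ g))) (τ k)   ≡⟨ cong (λ γ → conj (σ γ) (τ k)) (π∘τ g) ⟩
        conj (σ (π g)) (τ k)       ≡⟨ sym (conj-via-σ g (K-τ kk)) ⟩
        conj g (τ k)               ≡⟨ cong (conj g) (sym (restriction-K τ kk)) ⟩
        conj g (restriction τ k)   ∎

  module _ {h α} (fixed : IsFixedIms Γ T h) (autΓ : IsAutΓ Γ T α) where
    private
      aut = assemble-aut fixed autΓ
      spec = conjugator-spec (proj₁ aut) (proj₁ (proj₂ aut))
      α-outside = proj₁ autΓ
      α-K = proj₁ (proj₂ autΓ)
      α-ε = Glue.θ-ε G α σ (proj₁ (proj₂ (proj₂ autΓ)) _ _)

    conjugator-assemble : conjugator (assemble h α) ≡ h
    conjugator-assemble = K-conjugator-unique (proj₁ spec) (proj₁ fixed) λ γ → begin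
      conj (conjugator (assemble h α)) (σ γ)  ≡⟨ sym (proj₂ spec γ) ⟩
      conj h (α (κ (σ γ)) ∙ σ (π (σ γ)))      ≡⟨ cong₂ (λ k δ → conj h (α k ∙ σ δ)) (κ-σ γ) (π∘σ γ) ⟩
      conj h (α ε ∙ σ γ)                      ≡⟨ cong (λ k → conj h (k ∙ σ γ)) α-ε ⟩
      conj h (ε ∙ σ γ)                        ≡⟨ cong (conj h) (identityˡ (σ γ)) ⟩
      conj h (σ γ)                            ∎

    restriction-assemble : ∀ x → restriction (assemble h α) x ≡ α x
    restriction-assemble x with π x ≟ Γ.ε
    ... | no ¬kx = sym (α-outside x ¬kx)
    ... | yes kx = begin
      conj h (α (κ x) ∙ σ (π x))   ≡⟨ cong₂ (λ k γ → conj h (α k ∙ σ γ)) (κ-K kx) kx ⟩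
      conj h (α x ∙ σ Γ.ε)         ≡⟨ cong (λ z → conj h (α x ∙ z)) σ-ε ⟩
      conj h (α x ∙ ε)             ≡⟨ cong (conj h) (identityʳ _) ⟩
      conj h (α x)                 ≡⟨ K-conj-K (proj₁ fixed) (α-K x kx) ⟩
      α x                          ∎

  IsAut-resp : ∀ {τ τ′} → (∀ x → τ x ≡ τ′ x) → IsAut Γ T τ → IsAut Γ T τ′
  IsAut-resp {τ} {τ′} e (τ-hom , π∘τ , τ∘c , τ-injective , τ-surjective) =
    (λ x y → trans (sym (e _)) (trans (τ-hom x y) (cong₂ _∙_ (e x) (e y)))) ,
    (λ x → trans (cong π (sym (e x))) (π∘τ x)) ,
    (λ x → trans (sym (e _)) (τ∘c x)) ,
    (λ x y q → τ-injective x y (trans (e x) (trans q (sym (e y))))) ,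
    (λ y → proj₁ (τ-surjective y) , trans (sym (e _)) (proj₂ (τ-surjective y)))

  IsAutΓ-resp : ∀ {α α′} → (∀ x → α x ≡ α′ x) → IsAutΓ Γ T α → IsAutΓ Γ T α′
  IsAutΓ-resp {α} {α′} e (α-outside , α-K , α-hom , α-injective , α-surjective , α-equivariant) =
    (λ x ¬kx → trans (sym (e x)) (α-outside x ¬kx)) ,
    (λ k kk → subst K (e k) (α-K k kk)) ,
    (λ k l kk kl → trans (sym (e _)) (trans (α-hom k l kk kl) (cong₂ _∙_ (e k) (e l)))) ,
    (λ k l kk kl q → α-injective k l kk kl (trans (e k) (trans q (sym (e l))))) ,
    (λ l kl → let (k , kk , αk≡l) = α-surjective l kl in k , kk , trans (sym (e k)) αk≡l) ,
    (λ g k kk → trans (sym (e _)) (trans (α-equivariant g k kk) (cong (conj g) (e k))))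

  assemble-cong : ∀ h {α α′} → (∀ x → α x ≡ α′ x) → ∀ x → assemble h α x ≡ assemble h α′ x
  assemble-cong h e x = cong (λ k → conj h (k ∙ σ (π x))) (e (κ x))

  aut-decomposes : Decomposes (IsAut Γ T) (IsFixedIms Γ T) (IsAutΓ Γ T)
  aut-decomposes = record
    { part₁ = conjugator
    ; part₂ = restriction
    ; join = assemble
    ; P-resp = IsAut-resp
    ; R-resp = IsAutΓ-resp
    ; part₁-cong = conjugator-cong
    ; part₂-cong = restriction-cong
    ; join-cong = assemble-cong
    ; part₁-Q = conjugator-fixed
    ; part₂-R = restriction-autΓ
    ; join-P = assemble-aut
    ; join-parts = λ aut → assemble-parts (proj₁ aut) (proj₁ (proj₂ aut))
    ; part₁-join = conjugator-assemble
    ; part₂-join = restriction-assemble }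

  aut-count : autCount Γ T ≡ fixCount Γ T * autΓCount Γ T
  aut-count = countFun-decomposes (isAut? Γ T) (isFixedIms? Γ T) (isAutΓ? Γ T) aut-decomposes

-- The composite θ : K₁ ≅ M ≅ K₂ is Γ-equivariant,
-- so gluing it with the compatible splitting of T₂ gives a morphism
-- g ↦ θ (κ₁ g) · σ₂ (π₁ g); the same construction backwards inverts it.
module Transfer (Γ : FinGroup) (s : El GalCR → El Γ) (s-hom : IsHom GalCR Γ s) (M : GammaModule Γ)
    (T₁ T₂ : ClassTriple Γ s) (I₁ : KerIso Γ T₁ M) (I₂ : KerIso Γ T₂ M) where

  open import Data.Product using (proj₁; proj₂)
  open import Relation.Binary.PropositionalEquality

  module A = Decomposition Γ s s-hom T₁
  module B = Decomposition Γ s s-hom T₂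
  private
    module M = GammaModule M
    module H = GroupFacts M.H
  open ≡-Reasoning

  private
    φ₁ = proj₁ I₁
    φ₁-hom = proj₁ (proj₂ I₁)
    φ₁-equivariant = proj₂ (proj₂ (proj₂ (proj₂ I₁)))
    φ₂ = proj₁ I₂
    φ₂-hom = proj₁ (proj₂ I₂)
    φ₂-injective = proj₁ (proj₂ (proj₂ I₂))
    φ₂-surjective = proj₁ (proj₂ (proj₂ (proj₂ I₂)))
    φ₂-equivariant = proj₂ (proj₂ (proj₂ (proj₂ I₂)))

  φ₂⁻¹ : El M.H → El B.G
  φ₂⁻¹ x = proj₁ (φ₂-surjective x)

  K-φ₂⁻¹ : ∀ x → B.K (φ₂⁻¹ x)
  K-φ₂⁻¹ x = proj₁ (proj₂ (φ₂-surjective x))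

  φ₂∘φ₂⁻¹ : ∀ x → φ₂ (φ₂⁻¹ x) ≡ x
  φ₂∘φ₂⁻¹ x = proj₂ (proj₂ (φ₂-surjective x))

  θ : El A.G → El B.G
  θ k = φ₂⁻¹ (φ₁ k)

  K-θ : ∀ k → B.K (θ k)
  K-θ k = K-φ₂⁻¹ (φ₁ k)

  θ-hom : ∀ {a b} → A.K a → A.K b → θ (a A.∙ b) ≡ θ a B.∙ θ b
  θ-hom {a} {b} ka kb = φ₂-injective _ _ (K-θ _) (B.K-∙ (K-θ a) (K-θ b)) (begin
    φ₂ (θ (a A.∙ b))          ≡⟨ φ₂∘φ₂⁻¹ _ ⟩
    φ₁ (a A.∙ b)              ≡⟨ φ₁-hom a b ka kb ⟩
    φ₁ a H.∙ φ₁ b             ≡⟨ sym (cong₂ H._∙_ (φ₂∘φ₂⁻¹ _) (φ₂∘φ₂⁻¹ _)) ⟩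
    φ₂ (θ a) H.∙ φ₂ (θ b)     ≡⟨ sym (φ₂-hom _ _ (K-θ a) (K-θ b)) ⟩
    φ₂ (θ a B.∙ θ b)          ∎)

  θ-equivariant : ∀ γ {k} → A.K k → θ (A.conj (A.σ γ) k) ≡ B.conj (B.σ γ) (θ k)
  θ-equivariant γ {k} kk = φ₂-injective _ _ (K-θ _) (B.K-conj _ (K-θ k)) (begin
    φ₂ (θ (A.conj (A.σ γ) k))           ≡⟨ φ₂∘φ₂⁻¹ _ ⟩
    φ₁ (A.conj (A.σ γ) k)               ≡⟨ φ₁-equivariant _ k kk ⟩
    M.act (A.π (A.σ γ)) (φ₁ k)          ≡⟨ cong₂ M.act (trans (A.π∘σ γ) (sym (B.π∘σ γ))) (sym (φ₂∘φ₂⁻¹ _)) ⟩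
    M.act (B.π (B.σ γ)) (φ₂ (θ k))      ≡⟨ sym (φ₂-equivariant _ _ (K-θ k)) ⟩
    φ₂ (B.conj (B.σ γ) (θ k))           ∎)

  open A.Glue B.G θ B.σ using (glue; glue-hom; glue-c)

  τ : El A.G → El B.G
  τ = glue

  τ-π : ∀ g → B.π (τ g) ≡ A.π g
  τ-π g = B.π-kσ (A.π g) (K-θ _)

  τ-κ : ∀ g → B.κ (τ g) ≡ θ (A.κ g)
  τ-κ g = B.κ-kσ (A.π g) (K-θ _)

  τ-hom : IsHom A.G B.G τ
  τ-hom = glue-hom B.σ-hom θ-hom θ-equivariant

  τ-c : ∀ x → τ (A.c x) ≡ B.c x
  τ-c = glue-c θ-hom B.σ∘s

-- The transfers T₁ → T₂ and T₂ → T₁ are mutually inverse, since the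
-- kernel isomorphisms K₁ ≅ M ≅ K₂ and K₂ ≅ M ≅ K₁ are.
module Uniqueness (Γ : FinGroup) (s : El GalCR → El Γ) (s-hom : IsHom GalCR Γ s) (M : GammaModule Γ) where

  open import Data.Product using (proj₁; proj₂)
  open import Relation.Binary.PropositionalEquality
  open ≡-Reasoning

  transfer-inverse : ∀ (T₁ T₂ : ClassTriple Γ s) (I₁ : KerIso Γ T₁ M) (I₂ : KerIso Γ T₂ M) g →
    Transfer.τ Γ s s-hom M T₂ T₁ I₂ I₁ (Transfer.τ Γ s s-hom M T₁ T₂ I₁ I₂ g) ≡ g
  transfer-inverse T₁ T₂ I₁ I₂ g = begin
    Y.θ (B.κ (X.τ g)) A.∙ A.σ (B.π (X.τ g))  ≡⟨ cong₂ A._∙_ (cong Y.θ (X.τ-κ g)) (cong A.σ (X.τ-π g)) ⟩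
    Y.θ (X.θ (A.κ g)) A.∙ A.σ (A.π g)        ≡⟨ cong (A._∙ A.σ (A.π g)) θ-round-trip ⟩
    A.κ g A.∙ A.σ (A.π g)                    ≡⟨ A.κ-factor g ⟩
    g                                        ∎
    where
    module X = Transfer Γ s s-hom M T₁ T₂ I₁ I₂
    module Y = Transfer Γ s s-hom M T₂ T₁ I₂ I₁
    module A = X.A
    module B = X.B
    φ₁-injective = proj₁ (proj₂ (proj₂ I₁))
    -- both sides have image φ₁ (κ g) in M
    θ-round-trip : Y.θ (X.θ (A.κ g)) ≡ A.κ g
    θ-round-trip = φ₁-injective _ _ (Y.K-θ _) (A.K-κ g) (trans (Y.φ₂∘φ₂⁻¹ _) (X.φ₂∘φ₂⁻¹ _))

  iso : (T₁ T₂ : ClassTriple Γ s) → KerIso Γ T₁ M → KerIso Γ T₂ M → TripleIso Γ T₁ T₂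
  iso T₁ T₂ I₁ I₂ = X.τ , Y.τ , X.τ-hom , X.τ-π , X.τ-c , transfer-inverse T₁ T₂ I₁ I₂ , transfer-inverse T₂ T₁ I₂ I₁
    where
    module X = Transfer Γ s s-hom M T₁ T₂ I₁ I₂
    module Y = Transfer Γ s s-hom M T₂ T₁ I₂ I₁

module Transport {A : Set} (N : ℕ) (enc : A → Fin N) (dec : Fin N → A)
    (dec∘enc : ∀ a → dec (enc a) ≡ a) (enc∘dec : ∀ x → enc (dec x) ≡ x)
    (_·_ : A → A → A) (e : A) (inv : A → A) (isGroupA : IsGroup _≡_ _·_ e inv) where

  open import Relation.Binary.PropositionalEquality
  private module A = IsGroup isGroupA

  group : FinGroup
  group = record
    { size = N
    ; _∙_ = λ x y → enc (dec x · dec y)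
    ; ε = enc e
    ; _⁻¹ = λ x → enc (inv (dec x))
    ; isGroup = record
      { isMonoid = record
        { isSemigroup = record
          { isMagma = record { isEquivalence = isEquivalence ; ∙-cong = cong₂ _ }
          ; assoc = λ x y z → cong enc (trans (cong (_· dec z) (dec∘enc _))
                               (trans (A.assoc _ _ _) (cong (dec x ·_) (sym (dec∘enc _))))) }
        ; identity = (λ x → trans (cong enc (trans (cong (_· dec x) (dec∘enc e)) (A.identityˡ _))) (enc∘dec x))
                   , (λ x → trans (cong enc (trans (cong (dec x ·_) (dec∘enc e)) (A.identityʳ _))) (enc∘dec x)) }
      ; inverse = (λ x → cong enc (trans (cong (_· dec x) (dec∘enc _)) (A.inverseˡ _)))
                , (λ x → cong enc (trans (cong (dec x ·_) (dec∘enc _)) (A.inverseʳ _)))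
      ; ⁻¹-cong = cong (λ x → enc (inv (dec x))) } }

  open FinGroup group using (_∙_; _⁻¹)

  dec-∙ : ∀ x y → dec (x ∙ y) ≡ dec x · dec y
  dec-∙ x y = dec∘enc _

  dec-⁻¹ : ∀ x → dec (x ⁻¹) ≡ inv (dec x)
  dec-⁻¹ x = dec∘enc _

module SemidirectProduct (Γ : FinGroup) (M : GammaModule Γ) where

  open import Data.Fin using (combine; remQuot)
  open import Data.Fin.Properties using (remQuot-combine; combine-remQuot)
  open import Relation.Binary.PropositionalEquality

  module M = GammaModule M
  module H = GroupFacts M.H
  module Γ = GroupFacts Γ
  open M using (act)
  open ≡-Reasoning

  act-ε : ∀ γ → act γ H.ε ≡ H.ε
  act-ε γ = H.identityʳ-unique (act γ H.ε) (act γ H.ε)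
    (trans (sym (M.act-hom γ H.ε H.ε)) (cong (act γ) (H.identityˡ H.ε)))

  Pair : Set
  Pair = El M.H × El Γ

  _·_ : Pair → Pair → Pair
  (x , γ) · (y , δ) = (x H.∙ act γ y) , (γ Γ.∙ δ)

  e : Pair
  e = H.ε , Γ.ε

  inv : Pair → Pair
  inv (x , γ) = act (γ Γ.⁻¹) (x H.⁻¹) , γ Γ.⁻¹

  ⋊-assoc : ∀ a b c → (a · b) · c ≡ a · (b · c)
  ⋊-assoc (x , γ) (y , δ) (z , ε′) = cong₂ _,_ (begin
    (x H.∙ act γ y) H.∙ act (γ Γ.∙ δ) z           ≡⟨ cong ((x H.∙ act γ y) H.∙_) (M.act-comp γ δ z) ⟩
    (x H.∙ act γ y) H.∙ act γ (act δ z)           ≡⟨ H.assoc _ _ _ ⟩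
    x H.∙ (act γ y H.∙ act γ (act δ z))           ≡⟨ cong (x H.∙_) (sym (M.act-hom γ y _)) ⟩
    x H.∙ act γ (y H.∙ act δ z)                   ∎) (Γ.assoc γ δ ε′)

  ⋊-identityˡ : ∀ a → e · a ≡ a
  ⋊-identityˡ (x , γ) = cong₂ _,_ (trans (H.identityˡ _) (M.act-id x)) (Γ.identityˡ γ)

  ⋊-identityʳ : ∀ a → a · e ≡ a
  ⋊-identityʳ (x , γ) = cong₂ _,_ (trans (cong (x H.∙_) (act-ε γ)) (H.identityʳ x)) (Γ.identityʳ γ)

  ⋊-inverseˡ : ∀ a → inv a · a ≡ e
  ⋊-inverseˡ (x , γ) = cong₂ _,_ (begin
    act (γ Γ.⁻¹) (x H.⁻¹) H.∙ act (γ Γ.⁻¹) x     ≡⟨ sym (M.act-hom _ _ _) ⟩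
    act (γ Γ.⁻¹) (x H.⁻¹ H.∙ x)                  ≡⟨ cong (act (γ Γ.⁻¹)) (H.inverseˡ x) ⟩
    act (γ Γ.⁻¹) H.ε                             ≡⟨ act-ε _ ⟩
    H.ε                                          ∎) (Γ.inverseˡ γ)

  ⋊-inverseʳ : ∀ a → a · inv a ≡ e
  ⋊-inverseʳ (x , γ) = cong₂ _,_ (begin
    x H.∙ act γ (act (γ Γ.⁻¹) (x H.⁻¹))          ≡⟨ cong (x H.∙_) (sym (M.act-comp _ _ _)) ⟩
    x H.∙ act (γ Γ.∙ γ Γ.⁻¹) (x H.⁻¹)            ≡⟨ cong (λ δ → x H.∙ act δ (x H.⁻¹)) (Γ.inverseʳ γ) ⟩
    x H.∙ act Γ.ε (x H.⁻¹)                       ≡⟨ cong (x H.∙_) (M.act-id _) ⟩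
    x H.∙ x H.⁻¹                                 ≡⟨ H.inverseʳ x ⟩
    H.ε                                          ∎) (Γ.inverseʳ γ)

  isGroup-⋊ : IsGroup _≡_ _·_ e inv
  isGroup-⋊ = record
    { isMonoid = record
      { isSemigroup = record
        { isMagma = record { isEquivalence = isEquivalence ; ∙-cong = cong₂ _·_ }
        ; assoc = ⋊-assoc }
      ; identity = ⋊-identityˡ , ⋊-identityʳ }
    ; inverse = ⋊-inverseˡ , ⋊-inverseʳ
    ; ⁻¹-cong = cong inv }

  -- conjugating (y, ε) by (x, γ) gives (γ y, ε), as M is abelian
  conj-⋊ : ∀ x γ y → (((x , γ) · (y , Γ.ε)) · inv (x , γ)) ≡ (act γ y , Γ.ε)
  conj-⋊ x γ y = cong₂ _,_ (begin
    (x H.∙ act γ y) H.∙ act (γ Γ.∙ Γ.ε) (act (γ Γ.⁻¹) (x H.⁻¹))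
      ≡⟨ cong ((x H.∙ act γ y) H.∙_) (sym (M.act-comp _ _ _)) ⟩
    (x H.∙ act γ y) H.∙ act ((γ Γ.∙ Γ.ε) Γ.∙ γ Γ.⁻¹) (x H.⁻¹)
      ≡⟨ cong (λ δ → (x H.∙ act γ y) H.∙ act δ (x H.⁻¹)) γεγ⁻¹ ⟩
    (x H.∙ act γ y) H.∙ act Γ.ε (x H.⁻¹)   ≡⟨ cong ((x H.∙ act γ y) H.∙_) (M.act-id _) ⟩
    (x H.∙ act γ y) H.∙ x H.⁻¹             ≡⟨ cong (H._∙ x H.⁻¹) (M.comm x _) ⟩
    (act γ y H.∙ x) H.∙ x H.⁻¹             ≡⟨ H.//-rightDividesʳ x _ ⟩
    act γ y                                ∎) γεγ⁻¹
    where
    γεγ⁻¹ : (γ Γ.∙ Γ.ε) Γ.∙ γ Γ.⁻¹ ≡ Γ.ε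
    γεγ⁻¹ = trans (cong (Γ._∙ γ Γ.⁻¹) (Γ.identityʳ γ)) (Γ.inverseʳ γ)

  N : ℕ
  N = FinGroup.size M.H * FinGroup.size Γ

  enc : Pair → Fin N
  enc (x , γ) = combine x γ

  dec : Fin N → Pair
  dec = remQuot (FinGroup.size Γ)

  dec∘enc : ∀ p → dec (enc p) ≡ p
  dec∘enc (x , γ) = remQuot-combine x γ

  enc∘dec : ∀ g → enc (dec g) ≡ g
  enc∘dec = combine-remQuot {FinGroup.size M.H} (FinGroup.size Γ)

  open Transport N enc dec dec∘enc enc∘dec _·_ e inv isGroup-⋊ public using (dec-∙; dec-⁻¹)
    renaming (group to M⋊Γ)

-- Existence: M ⋊ Γ with π the projection to Γ and c x = (ε, s x) is a
-- class triple for s, whose kernel {(x, ε)} is M as a Γ-module.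
module Existence (Γ : FinGroup) (s : El GalCR → El Γ) (s-hom : IsHom GalCR Γ s) (M : GammaModule Γ)
    (coprime : Coprime (size (GammaModule.H M)) (size Γ)) (fixed-trivial : ModFixTrivial Γ M) where

  open import Data.Fin.Properties using (_≟_)
  open import Data.List.Properties using (length-tabulate)
  open import Data.Product using (proj₁; proj₂)
  open import Data.Unit using (tt)
  open import Relation.Binary.PropositionalEquality

  open SemidirectProduct Γ M
  open M using (act)
  module G = GroupFacts M⋊Γ
  open ≡-Reasoning

  π : El M⋊Γ → El Γ
  π g = proj₂ (dec g)

  π-hom : IsHom M⋊Γ Γ π
  π-hom x y = cong proj₂ (dec-∙ x y)

  c : El GalCR → El M⋊Γ
  c x = enc (H.ε , s x)

  c-hom : IsHom GalCR M⋊Γ c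
  c-hom x y = cong enc (sym (trans (cong₂ _·_ (dec∘enc _) (dec∘enc _))
    (cong₂ _,_ (trans (cong (H.ε H.∙_) (act-ε _)) (H.identityˡ _)) (sym (s-hom x y)))))

  μ : El M⋊Γ → El M.H
  μ g = proj₁ (dec g)

  Kernel : El M⋊Γ → Set
  Kernel g = π g ≡ Γ.ε

  kernel-dec : ∀ {k} → Kernel k → dec k ≡ (μ k , Γ.ε)
  kernel-dec kk = cong₂ _,_ refl kk

  kernel-enc : ∀ {k} → Kernel k → k ≡ enc (μ k , Γ.ε)
  kernel-enc {k} kk = trans (sym (enc∘dec k)) (cong enc (kernel-dec kk))

  dec-conj : ∀ g {k} → Kernel k → dec (G.conj g k) ≡ (act (π g) (μ k) , Γ.ε)
  dec-conj g {k} kk = begin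
    dec (G.conj g k)                              ≡⟨ trans (dec-∙ _ _) (cong₂ _·_ (dec-∙ g k) (dec-⁻¹ g)) ⟩
    (dec g · dec k) · inv (dec g)                 ≡⟨ cong (λ p → (dec g · p) · inv (dec g)) (kernel-dec kk) ⟩
    (dec g · (μ k , Γ.ε)) · inv (dec g)           ≡⟨ conj-⋊ (μ g) (π g) (μ k) ⟩
    (act (π g) (μ k) , Γ.ε)                       ∎

  μ-mul : ∀ {k l} → Kernel k → Kernel l → μ (k G.∙ l) ≡ μ k H.∙ μ l
  μ-mul {k} {l} kk kl = trans (cong proj₁ (dec-∙ k l))
    (trans (cong (λ γ → μ k H.∙ act γ (μ l)) kk) (cong (μ k H.∙_) (M.act-id _)))

  kernel-abelian : ∀ x y → Kernel x → Kernel y → x G.∙ y ≡ y G.∙ x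
  kernel-abelian x y kx ky = cong enc (begin
    dec x · dec y                        ≡⟨ cong₂ _·_ (kernel-dec kx) (kernel-dec ky) ⟩
    (μ x , Γ.ε) · (μ y , Γ.ε)            ≡⟨ cong₂ _,_ (trans (cong (μ x H.∙_) (M.act-id _))
                                              (trans (M.comm _ _) (cong (μ y H.∙_) (sym (M.act-id _))))) refl ⟩
    (μ y , Γ.ε) · (μ x , Γ.ε)            ≡⟨ sym (cong₂ _·_ (kernel-dec ky) (kernel-dec kx)) ⟩
    dec y · dec x                        ∎)

  kernel-order : countFin (λ g → π g ≟ Γ.ε) ≡ FinGroup.size M.H
  kernel-order = trans
    (Counting.length-bijection
      (Counting.filter-lists (λ g → π g ≟ Γ.ε) (Counting.allFin-enumerates N))
      (Counting.allFin-enumerates (FinGroup.size M.H))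
      μ (λ x → enc (x , Γ.ε)) (λ _ → tt) (λ _ → cong proj₂ (dec∘enc _))
      (λ kk → sym (kernel-enc kk)) (λ _ → cong proj₁ (dec∘enc _)))
    (length-tabulate (λ i → i))

  -- condition (iii): conjugation by (ε, γ) acts on the kernel as γ acts on
  -- M, and M^Γ is trivial
  kernel-fix-trivial : ∀ k → Kernel k → (∀ γ g → π g ≡ γ → G.conj g k ≡ k) → k ≡ G.ε
  kernel-fix-trivial k kk fixed = trans (kernel-enc kk) (cong enc (cong₂ _,_ μk≡ε refl))
    where
    μk≡ε : μ k ≡ H.ε
    μk≡ε = fixed-trivial (μ k) λ γ → begin
      act γ (μ k)                                   ≡⟨ cong (λ δ → act δ (μ k)) (sym (cong proj₂ (dec∘enc (H.ε , γ)))) ⟩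
      act (π (enc (H.ε , γ))) (μ k)                 ≡⟨ cong proj₁ (sym (dec-conj (enc (H.ε , γ)) kk)) ⟩
      μ (G.conj (enc (H.ε , γ)) k)                  ≡⟨ cong μ (fixed γ _ (cong proj₂ (dec∘enc _))) ⟩
      μ k                                           ∎

  -- (iv) holds since c x = (ε, s x) lies in the kernel only if s x = ε
  triple : ClassTriple Γ s
  triple = record
    { G = M⋊Γ
    ; π = π
    ; π-hom = π-hom
    ; π-surj = λ γ → enc (H.ε , γ) , cong proj₂ (dec∘enc _)
    ; c = c
    ; c-hom = c-hom
    ; π∘c≡s = λ x → cong proj₂ (dec∘enc _)
    ; ker-abelian = kernel-abelian
    ; ker-coprime = subst (λ n → Coprime n (size Γ)) (sym kernel-order) coprime
    ; ker-fix-trivial = kernel-fix-trivial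
    ; imc∩ker = λ x kx → cong enc (cong₂ _,_ refl (trans (sym (cong proj₂ (dec∘enc (H.ε , s x)))) kx)) }

  kernel-iso : KerIso Γ triple M
  kernel-iso =
    μ ,
    (λ k l kk kl → μ-mul kk kl) ,
    (λ k l kk kl μk≡μl → trans (kernel-enc kk) (trans (cong enc (cong₂ _,_ μk≡μl refl)) (sym (kernel-enc kl)))) ,
    (λ x → enc (x , Γ.ε) , cong proj₂ (dec∘enc _) , cong proj₁ (dec∘enc _)) ,
    (λ g k kk → cong proj₁ (dec-conj g kk))

theorem5p1 : (Γ : FinGroup) (s : El GalCR → El Γ) → IsHom GalCR Γ s →
    ((T : ClassTriple Γ s) →
      autCount Γ T ≡ fixCount Γ T * autΓCount Γ T)
    × ((M : GammaModule Γ) →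
      Coprime (size (GammaModule.H M)) (size Γ) → ModFixTrivial Γ M →
      Σ (ClassTriple Γ s) (λ T → KerIso Γ T M)
      × ((T₁ T₂ : ClassTriple Γ s) → KerIso Γ T₁ M → KerIso Γ T₂ M →
        TripleIso Γ T₁ T₂))
theorem5p1 Γ s s-hom = count , classification
  where
  count : (T : ClassTriple Γ s) → autCount Γ T ≡ fixCount Γ T * autΓCount Γ T
  count T = Automorphisms.aut-count Γ s s-hom T

  classification : (M : GammaModule Γ) → Coprime (size (GammaModule.H M)) (size Γ) → ModFixTrivial Γ M →
    Σ (ClassTriple Γ s) (λ T → KerIso Γ T M)
    × ((T₁ T₂ : ClassTriple Γ s) → KerIso Γ T₁ M → KerIso Γ T₂ M → TripleIso Γ T₁ T₂)
  classification M coprime fixed-trivial =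
    (E.triple , E.kernel-iso) , Uniqueness.iso Γ s s-hom M
    where module E = Existence Γ s s-hom M coprime fixed-trivial
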